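{- Let $G$ be a simple graph and let $u,v\in V(G)$ with $\mathrm{dis}(u,v)=2$. Then $\mathbf{a}_4(G)\ge \mathbf{a}_4(G_{u\rightarrow v})$, and the inequality is strict if $\mathbf{N}_G(\bar{u},v)\neq\emptyset$ and $\mathbf{N}_G(u,\bar{v})\neq\emptyset$.
   Context: All graphs are finite, simple and undirected. For a graph $G$ on $n$ vertices with adjacency matrix $\mathbf{A}(G)$, write $\det(\lambda I-\mathbf{A}(G))=\sum_{i=0}^n \mathbf{a}_i(G)\lambda^{n-i}$; $\mathbf{a}_4(G)$ is the coefficient of $\lambda^{n-4}$ (equivalently, $\mathbf{a}_4(G)$ equals the number of $2$-matchings of $G$ minus twice the number of $4$-cycles of $G$ plus a term $-2c_3$-free contribution only from $4$-vertex Sachs subgraphs; for the purposes here it is the coefficient just defined). $\mathrm{dis}(u,v)$ is the distance between $u$ and $v$. For vertices $u,v$: $\mathbf{N}_G(u,\bar v)=\{x\in V(G)\setminus\{u,v\}: xu\in E(G),\ xv\notin E(G)\}$ and $\mathbf{N}_G(\bar u,v)=\{x\in V(G)\setminus\{u,v\}: xu\notin E(G),\ xv\in E(G)\}$. The compression $G_{u\rightarrow v}$ is the graph obtained from $G$ by deleting all edges between $u$ and $\mathbf{N}_G(u,\bar v)$ and adding all edges from $v$ to $\mathbf{N}_G(u,\bar v)$. -}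

module Defs where

open import Data.Bool using (Bool; true; false; if_then_else_; _∧_; _∨_; not; T)
open import Data.Nat using (ℕ; zero; suc; _∸_; _≤_; _<_; _≤?_)
open import Data.Integer as ℤ using (ℤ; +_; -_)
open import Data.Fin using (Fin; zero; suc; punchIn)
open import Data.Fin.Properties using (_≟_)
open import Data.List using (List; []; _∷_)
open import Data.Product using (Σ; _×_; _,_)
open import Relation.Nullary using (¬_; ⌊_⌋)
open import Relation.Binary.PropositionalEquality using (_≡_)

record SimpleGraph (n : ℕ) : Set where
  field
    adj     : Fin n → Fin n → Bool
    sym     : ∀ x y → adj x y ≡ adj y x
    irrefl  : ∀ x → adj x x ≡ false
open SimpleGraph public

Adj : ℕ → Set
Adj n = Fin n → Fin n → Bool

data Walk {n : ℕ} (A : Adj n) : Fin n → Fin n → ℕ → Set where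
  here : ∀ {x} → Walk A x x zero
  step : ∀ {x y z k} → T (A x y) → Walk A y z k → Walk A x z (suc k)

Dis : ∀ {n} → SimpleGraph n → Fin n → Fin n → ℕ → Set
Dis G u v d = Walk (adj G) u v d × (∀ k → k < d → ¬ Walk (adj G) u v k)

_==_ : ∀ {n} → Fin n → Fin n → Bool
x == y = ⌊ x ≟ y ⌋

inN-u-v̄ : ∀ {n} → Adj n → Fin n → Fin n → Fin n → Bool
inN-u-v̄ A u v x = not (x == u) ∧ not (x == v) ∧ A x u ∧ not (A x v)

inN-ū-v : ∀ {n} → Adj n → Fin n → Fin n → Fin n → Bool
inN-ū-v A u v x = not (x == u) ∧ not (x == v) ∧ not (A x u) ∧ A x v

-- Compression G_{u→v}: delete edges u–N(u,v̄), add edges v–N(u,v̄)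

compress : ∀ {n} → Adj n → Fin n → Fin n → Adj n
compress A u v x y =
  if ((x == u) ∧ inN-u-v̄ A u v y) ∨ ((y == u) ∧ inN-u-v̄ A u v x)
  then false
  else (if ((x == v) ∧ inN-u-v̄ A u v y) ∨ ((y == v) ∧ inN-u-v̄ A u v x)
        then true
        else A x y)

-- Polynomials over ℤ as coefficient lists (lowest degree first)

Poly : Set
Poly = List ℤ

_⊕_ : Poly → Poly → Poly
[] ⊕ q = q
(a ∷ p) ⊕ [] = a ∷ p
(a ∷ p) ⊕ (b ∷ q) = (a ℤ.+ b) ∷ (p ⊕ q)

scale : ℤ → Poly → Poly
scale c [] = []
scale c (a ∷ p) = (c ℤ.* a) ∷ scale c p

_⊗_ : Poly → Poly → Poly
[] ⊗ q = []
(a ∷ p) ⊗ q = scale a q ⊕ (+ 0 ∷ (p ⊗ q))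

coeff : Poly → ℕ → ℤ
coeff [] k = + 0
coeff (a ∷ p) zero = a
coeff (a ∷ p) (suc k) = coeff p k

sign : ℕ → ℤ
sign zero = + 1
sign (suc k) = - sign k

toℕ' : ∀ {n} → Fin n → ℕ
toℕ' zero = zero
toℕ' (suc i) = suc (toℕ' i)

sumFin : ∀ {n} → (Fin n → Poly) → Poly
sumFin {zero} f = []
sumFin {suc n} f = f zero ⊕ sumFin (λ i → f (suc i))

det : ∀ {n} → (Fin n → Fin n → Poly) → Poly
det {zero} M = + 1 ∷ []
det {suc n} M =
  sumFin (λ j → scale (sign (toℕ' j))
                  (M zero j ⊗ det (λ r c → M (suc r) (punchIn j c))))

charPoly : ∀ {n} → Adj n → Poly
charPoly A = det (λ i j →
  (if i == j then (+ 0 ∷ + 1 ∷ []) else [])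
  ⊕ (if A i j then (- (+ 1) ∷ []) else []))

-- a_i(A): coefficient of λ^{n-i} in det(λI − A)  (0 if i > n)
coeffA : ∀ {n} → Adj n → ℕ → ℤ
coeffA {n} A i with i ≤? n
... | Relation.Nullary.yes _ = coeff (charPoly A) (n ∸ i)
... | Relation.Nullary.no _  = + 0

a₄ : ∀ {n} → Adj n → ℤ
a₄ A = coeffA A 4

-- Expanding det(λI − A) row by row, a₄ is the sum over 4-sets X of the principal minors det(−A[X]),
-- and such a minor is the number of perfect matchings minus twice the number of 4-cycles of G[X].
-- The compression changes only edges at u and v, so 4-sets avoiding u and v contribute equally,
-- and a finite check over the possible adjacencies shows that a 4-set containing both cannot gain.
-- A 4-set containing only u may gain, but together with its image under the transposition (u v) it
-- again loses. The 4-set {u, v, x, y} with x ∈ N(ū, v) and y ∈ N(u, v̄) loses strictly.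

module Submission where

open import Defs hiding (sym)
import Data.Integer.Properties as ℤP
open import Algebra.Properties.Semiring.Sum ℤP.+-*-semiring
  using (sum; sum-cong-≗; sum-replicate-zero; sum-remove; ∑-distrib-+; *-distribˡ-sum)
open import Data.Bool as Bool using (Bool; true; false; if_then_else_; _∧_; _∨_; not; T)
import Data.Bool.Properties as BoolP
open import Data.Empty using (⊥; ⊥-elim)
open import Data.Fin as Fin using (Fin; zero; suc; punchIn; punchOut)
open import Data.Fin.Patterns using (0F; 1F; 2F; 3F)
open import Data.Fin.Permutation.Components using (transpose)
open import Data.Fin.Properties as FinP using (punchIn-injective; punchInᵢ≢i; punchIn-punchOut; all?; any?)
open import Data.Integer as ℤ using (ℤ; +_; -_; _+_; _*_; _-_; _≤_; _<_)
open import Data.Integer.Solver using (module +-*-Solver)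
open import Data.List using ([]; _∷_)
open import Data.Nat as ℕ using (ℕ; zero; suc; _∸_)
import Data.Nat.Properties as ℕP
open import Data.Product using (Σ; ∃; _×_; _,_; proj₁; proj₂)
open import Data.Vec.Functional using (updateAt; insertAt) renaming ([] to []ᵛ; _∷_ to _∷ᵛ_)
open import Data.Vec.Functional.Properties using (insertAt-lookup; insertAt-punchIn; updateAt-updates; updateAt-minimal)
open import Function using (_∘_; id; const; case_of_)
open import Function.Definitions using (Injective)
open import Relation.Binary.Core using (_Preserves_⟶_)
open import Relation.Binary.Definitions using (tri<; tri≈; tri>)
open import Relation.Binary.PropositionalEquality
open import Relation.Nullary using (¬_; Dec; yes; no; does)
open import Relation.Nullary.Decidable using (dec-true; dec-false; from-yes; ¬?; _→-dec_)
open import Relation.Unary using (Decidable)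

open +-*-Solver

sum-zero : ∀ {n} (f : Fin n → ℤ) → (∀ i → f i ≡ + 0) → sum f ≡ + 0
sum-zero {n} f h = trans (sum-cong-≗ h) (sum-replicate-zero n)

sum-single : ∀ {n} (c : Fin (suc n)) (f : Fin (suc n) → ℤ) →
             (∀ j → f (punchIn c j) ≡ + 0) → sum f ≡ f c
sum-single c f h = begin
  sum f                         ≡⟨ sum-remove {i = c} f ⟩
  f c + sum (f ∘ punchIn c)     ≡⟨ cong (λ s → f c + s) (sum-zero _ h) ⟩
  f c + + 0                     ≡⟨ ℤP.+-identityʳ (f c) ⟩
  f c                           ∎
  where open ≡-Reasoning

sign-+ : ∀ a b → sign (a ℕ.+ b) ≡ sign a * sign b
sign-+ zero    b = sym (ℤP.*-identityˡ (sign b))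
sign-+ (suc a) b = trans (cong -_ (sign-+ a b)) (ℤP.neg-distribˡ-* (sign a) (sign b))

sign-double : ∀ a → sign (a ℕ.+ a) ≡ + 1
sign-double zero    = refl
sign-double (suc a) = begin
  sign (suc a ℕ.+ suc a)   ≡⟨ cong (-_ ∘ sign) (ℕP.+-suc a a) ⟩
  - - sign (a ℕ.+ a)       ≡⟨ ℤP.neg-involutive _ ⟩
  sign (a ℕ.+ a)           ≡⟨ sign-double a ⟩
  + 1                      ∎
  where open ≡-Reasoning

Matrix : ℕ → Set
Matrix n = Fin n → Fin n → ℤ

minor : ∀ {n} {A : Set} → Fin (suc n) → Fin (suc n) →
        (Fin (suc n) → Fin (suc n) → A) → Fin n → Fin n → A
minor r c M i j = M (punchIn r i) (punchIn c j)

detℤ : ∀ {n} → Matrix n → ℤ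
detℤ {zero}  M = + 1
detℤ {suc n} M = sum λ j → sign (toℕ' j) * (M zero j * detℤ (minor zero j M))

detℤ-cong : ∀ {n} {M N : Matrix n} → (∀ i j → M i j ≡ N i j) → detℤ M ≡ detℤ N
detℤ-cong {zero}  h = refl
detℤ-cong {suc n} h = sum-cong-≗ λ j →
  cong₂ (λ a b → sign (toℕ' j) * (a * b)) (h zero j) (detℤ-cong λ a b → h (suc a) (punchIn j b))

detℤ-zeroRow : ∀ {n} (M : Matrix n) r → (∀ j → M r j ≡ + 0) → detℤ M ≡ + 0
detℤ-zeroRow {suc n} M zero h = sum-zero _ λ j →
  trans (cong (λ a → sign (toℕ' j) * (a * detℤ (minor zero j M))) (h j))
        (solve 2 (λ s d → s :* (con (+ 0) :* d) := con (+ 0)) refl (sign (toℕ' j)) (detℤ (minor zero j M)))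
detℤ-zeroRow {suc (suc n)} M (suc r) h = sum-zero _ λ j →
  trans (cong (λ d → sign (toℕ' j) * (M zero j * d)) (detℤ-zeroRow (minor zero j M) r (h ∘ punchIn j)))
        (solve 2 (λ s m → s :* (m :* con (+ 0)) := con (+ 0)) refl (sign (toℕ' j)) (M zero j))

I : ∀ {n} → Matrix n
I i j = if i == j then + 1 else + 0

==-refl : ∀ {n} (i : Fin n) → (i == i) ≡ true
==-refl i with i FinP.≟ i
... | yes _  = refl
... | no i≢i = ⊥-elim (i≢i refl)

==-false : ∀ {n} {i j : Fin n} → ¬ i ≡ j → (i == j) ≡ false
==-false {i = i} {j} i≢j with i FinP.≟ j
... | yes i≡j = ⊥-elim (i≢j i≡j)
... | no _    = refl

I-punchIn : ∀ {n} (c : Fin (suc n)) i j → I (punchIn c i) (punchIn c j) ≡ I i j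
I-punchIn c i j with i FinP.≟ j
... | yes refl = cong (λ b → if b then + 1 else + 0) (==-refl (punchIn c i))
... | no i≢j   = cong (λ b → if b then + 1 else + 0) (==-false (i≢j ∘ punchIn-injective c i j))

I-off-diagonal : ∀ {n} (c : Fin (suc n)) j → I c (punchIn c j) ≡ + 0
I-off-diagonal c j = cong (λ b → if b then + 1 else + 0) (==-false (punchInᵢ≢i c j ∘ sym))

I-diagonal : ∀ {n} (c : Fin n) → I c c ≡ + 1
I-diagonal c = cong (λ b → if b then + 1 else + 0) (==-refl c)

-- Deleting column c and then column j equals deleting column punchIn c j and then the column c′ where c now sits.
punchIn-exchange : ∀ {m} (c : Fin (suc (suc m))) (j : Fin (suc m)) → ∃ λ c′ →
  punchIn (punchIn c j) c′ ≡ c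
  × (∀ y → punchIn (punchIn c j) (punchIn c′ y) ≡ punchIn c (punchIn j y))
  × sign (toℕ' (punchIn c j)) * sign (toℕ' c′) ≡ - (sign (toℕ' c) * sign (toℕ' j))
punchIn-exchange zero j = zero , refl , (λ _ → refl) ,
  solve 1 (λ s → (:- s) :* con (+ 1) := :- (con (+ 1) :* s)) refl (sign (toℕ' j))
punchIn-exchange (suc c) zero = c , refl , (λ _ → refl) ,
  solve 1 (λ s → con (+ 1) :* s := :- ((:- s) :* con (+ 1))) refl (sign (toℕ' c))
punchIn-exchange {suc m} (suc c) (suc j) with punchIn-exchange c j
... | c′ , position , columns , signs = suc c′ , cong suc position , columns′ , signs′
  where
  columns′ : ∀ y → punchIn (punchIn (suc c) (suc j)) (punchIn (suc c′) y) ≡ punchIn (suc c) (punchIn (suc j) y)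
  columns′ zero    = refl
  columns′ (suc y) = cong suc (columns y)
  signs′ : (- sign (toℕ' (punchIn c j))) * (- sign (toℕ' c′)) ≡ - ((- sign (toℕ' c)) * (- sign (toℕ' j)))
  signs′ = begin
    (- sign (toℕ' (punchIn c j))) * (- sign (toℕ' c′))
      ≡⟨ solve 2 (λ a b → (:- a) :* (:- b) := a :* b) refl (sign (toℕ' (punchIn c j))) (sign (toℕ' c′)) ⟩
    sign (toℕ' (punchIn c j)) * sign (toℕ' c′)
      ≡⟨ signs ⟩
    - (sign (toℕ' c) * sign (toℕ' j))
      ≡⟨ solve 2 (λ a b → :- (a :* b) := :- ((:- a) :* (:- b))) refl (sign (toℕ' c)) (sign (toℕ' j)) ⟩
    - ((- sign (toℕ' c)) * (- sign (toℕ' j))) ∎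
    where open ≡-Reasoning

exchange-signs : ∀ sj sj′ sc sc′ sr m Y → sj * sc′ ≡ - (sc * sj′) →
                 sj * (m * ((sr * sc′) * Y)) ≡ (- (sr * sc)) * (sj′ * (m * Y))
exchange-signs sj sj′ sc sc′ sr m Y signs = begin
  sj * (m * ((sr * sc′) * Y))
    ≡⟨ solve 5 (λ a b d e f → a :* (b :* ((d :* e) :* f)) := (a :* e) :* (d :* (b :* f))) refl sj m sr sc′ Y ⟩
  (sj * sc′) * (sr * (m * Y))
    ≡⟨ cong (_* (sr * (m * Y))) signs ⟩
  (- (sc * sj′)) * (sr * (m * Y))
    ≡⟨ solve 5 (λ a b d e f → (:- (a :* b)) :* (d :* (e :* f)) := (:- (d :* a)) :* (b :* (e :* f))) refl sc sj′ sr m Y ⟩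
  (- (sr * sc)) * (sj′ * (m * Y)) ∎
  where open ≡-Reasoning

detℤ-unitRow : ∀ {n} (M : Matrix (suc n)) (r c : Fin (suc n)) → (∀ j → M r j ≡ I c j) →
               detℤ M ≡ sign (toℕ' r ℕ.+ toℕ' c) * detℤ (minor r c M)
detℤ-unitRow {n} M zero c row = begin
  detℤ M                                    ≡⟨ sum-single c term off-c ⟩
  sign (toℕ' c) * (M zero c * d c)          ≡⟨ cong (λ a → sign (toℕ' c) * (a * d c)) (trans (row c) (I-diagonal c)) ⟩
  sign (toℕ' c) * (+ 1 * d c)               ≡⟨ cong (sign (toℕ' c) *_) (ℤP.*-identityˡ (d c)) ⟩
  sign (toℕ' c) * d c                       ∎
  where
  open ≡-Reasoning
  d : Fin (suc n) → ℤ
  d j = detℤ (minor zero j M)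
  term : Fin (suc n) → ℤ
  term j = sign (toℕ' j) * (M zero j * d j)
  off-c : ∀ j → term (punchIn c j) ≡ + 0
  off-c j = begin
    sign (toℕ' (punchIn c j)) * (M zero (punchIn c j) * d (punchIn c j))
      ≡⟨ cong (λ a → sign (toℕ' (punchIn c j)) * (a * d (punchIn c j))) (trans (row _) (I-off-diagonal c j)) ⟩
    sign (toℕ' (punchIn c j)) * (+ 0 * d (punchIn c j))
      ≡⟨ solve 2 (λ a b → a :* (con (+ 0) :* b) := con (+ 0)) refl (sign (toℕ' (punchIn c j))) (d (punchIn c j)) ⟩
    + 0 ∎
detℤ-unitRow {suc n} M (suc r) c row = begin
  detℤ M                                             ≡⟨ sum-remove {i = c} term ⟩
  term c + sum (term ∘ punchIn c)                     ≡⟨ cong (_+ sum (term ∘ punchIn c)) term-c ⟩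
  + 0 + sum (term ∘ punchIn c)                        ≡⟨ ℤP.+-identityˡ _ ⟩
  sum (term ∘ punchIn c)                              ≡⟨ sum-cong-≗ term-punchIn ⟩
  sum (λ j → s * term′ j)                             ≡⟨ sym (*-distribˡ-sum s term′) ⟩
  s * detℤ (minor (suc r) c M)                        ∎
  where
  open ≡-Reasoning
  s = sign (toℕ' (suc r) ℕ.+ toℕ' c)
  term : Fin (suc (suc n)) → ℤ
  term j = sign (toℕ' j) * (M zero j * detℤ (minor zero j M))
  term′ : Fin (suc n) → ℤ
  term′ j = sign (toℕ' j) * (M zero (punchIn c j) * detℤ (minor zero j (minor (suc r) c M)))
  -- Without column c, what is left of the unit row r is zero.
  term-c : term c ≡ + 0
  term-c = begin
    sign (toℕ' c) * (M zero c * detℤ (minor zero c M))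
      ≡⟨ cong (λ d → sign (toℕ' c) * (M zero c * d)) (detℤ-zeroRow (minor zero c M) r λ k → trans (row _) (I-off-diagonal c k)) ⟩
    sign (toℕ' c) * (M zero c * + 0)
      ≡⟨ solve 2 (λ a b → a :* (b :* con (+ 0)) := con (+ 0)) refl (sign (toℕ' c)) (M zero c) ⟩
    + 0 ∎
  term-punchIn : ∀ j → term (punchIn c j) ≡ s * term′ j
  term-punchIn j with punchIn-exchange c j
  ... | c′ , position , columns , signs = begin
    sj * (m * detℤ (minor zero (punchIn c j) M))
      ≡⟨ cong (λ d → sj * (m * d)) (detℤ-unitRow (minor zero (punchIn c j) M) r c′ row′) ⟩
    sj * (m * (sign (toℕ' r ℕ.+ toℕ' c′) * X))
      ≡⟨ cong (λ d → sj * (m * (sign (toℕ' r ℕ.+ toℕ' c′) * d))) (detℤ-cong λ x y → cong (M (suc (punchIn r x))) (columns y)) ⟩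
    sj * (m * (sign (toℕ' r ℕ.+ toℕ' c′) * Y))
      ≡⟨ cong (λ z → sj * (m * (z * Y))) (sign-+ (toℕ' r) (toℕ' c′)) ⟩
    sj * (m * ((sr * sc′) * Y))
      ≡⟨ exchange-signs sj sj′ sc sc′ sr m Y signs ⟩
    (- (sr * sc)) * (sj′ * (m * Y))
      ≡⟨ cong (λ z → (- z) * (sj′ * (m * Y))) (sym (sign-+ (toℕ' r) (toℕ' c))) ⟩
    s * (sj′ * (m * Y)) ∎
    where
    sj = sign (toℕ' (punchIn c j))
    sj′ = sign (toℕ' j)
    sc = sign (toℕ' c)
    sc′ = sign (toℕ' c′)
    sr = sign (toℕ' r)
    m = M zero (punchIn c j)
    X = detℤ (minor r c′ (minor zero (punchIn c j) M))
    Y = detℤ (minor zero j (minor (suc r) c M))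
    row′ : ∀ k → minor zero (punchIn c j) M r k ≡ I c′ k
    row′ k = begin
      M (suc r) (punchIn (punchIn c j) k)                          ≡⟨ row _ ⟩
      I c (punchIn (punchIn c j) k)                                ≡⟨ cong (λ z → I z (punchIn (punchIn c j) k)) (sym position) ⟩
      I (punchIn (punchIn c j) c′) (punchIn (punchIn c j) k)       ≡⟨ I-punchIn (punchIn c j) c′ k ⟩
      I c′ k                                                       ∎

coeff-⊕ : ∀ p q k → coeff (p ⊕ q) k ≡ coeff p k + coeff q k
coeff-⊕ []      q       k       = sym (ℤP.+-identityˡ _)
coeff-⊕ (a ∷ p) []      k       = sym (ℤP.+-identityʳ _)
coeff-⊕ (a ∷ p) (b ∷ q) zero    = refl
coeff-⊕ (a ∷ p) (b ∷ q) (suc k) = coeff-⊕ p q k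

coeff-scale : ∀ c p k → coeff (scale c p) k ≡ c * coeff p k
coeff-scale c []      k       = sym (ℤP.*-zeroʳ c)
coeff-scale c (a ∷ p) zero    = refl
coeff-scale c (a ∷ p) (suc k) = coeff-scale c p k

coeff-sumFin : ∀ {n} (f : Fin n → Poly) k → coeff (sumFin f) k ≡ sum (λ j → coeff (f j) k)
coeff-sumFin {zero}  f k = refl
coeff-sumFin {suc n} f k = trans (coeff-⊕ (f zero) _ k) (cong (λ s → coeff (f zero) k + s) (coeff-sumFin (f ∘ suc) k))

shift : (ℕ → ℤ) → ℕ → ℤ
shift f zero    = + 0
shift f (suc k) = f k

record Affine (p : Poly) (c d : ℤ) : Set where
  field
    coeff₀  : coeff p 0 ≡ c
    coeff₁  : coeff p 1 ≡ d
    coeff₂₊ : ∀ k → coeff p (suc (suc k)) ≡ + 0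

coeff-⊗-constant : ∀ r {d} → coeff r 0 ≡ d → (∀ k → coeff r (suc k) ≡ + 0) →
                   ∀ q k → coeff (r ⊗ q) k ≡ d * coeff q k
coeff-⊗-constant []      refl _      q k = sym (ℤP.*-zeroˡ (coeff q k))
coeff-⊗-constant (b ∷ r) refl higher q k = begin
  coeff (scale b q ⊕ (+ 0 ∷ (r ⊗ q))) k            ≡⟨ coeff-⊕ (scale b q) _ k ⟩
  coeff (scale b q) k + coeff (+ 0 ∷ (r ⊗ q)) k   ≡⟨ cong₂ _+_ (coeff-scale b q k) (vanishing k) ⟩
  b * coeff q k + + 0                             ≡⟨ ℤP.+-identityʳ _ ⟩
  b * coeff q k                                   ∎
  where
  open ≡-Reasoning
  vanishing : ∀ k → coeff (+ 0 ∷ (r ⊗ q)) k ≡ + 0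
  vanishing zero    = refl
  vanishing (suc k) = trans (coeff-⊗-constant r (higher 0) (higher ∘ suc) q k) (ℤP.*-zeroˡ (coeff q k))

coeff-⊗-affine : ∀ {p c d} → Affine p c d → ∀ q k → coeff (p ⊗ q) k ≡ c * coeff q k + d * shift (coeff q) k
coeff-⊗-affine {[]} record { coeff₀ = refl ; coeff₁ = refl } q k =
  solve 2 (λ a b → con (+ 0) := con (+ 0) :* a :+ con (+ 0) :* b) refl (coeff q k) (shift (coeff q) k)
coeff-⊗-affine {a ∷ p} {d = d} record { coeff₀ = refl ; coeff₁ = p₀≡d ; coeff₂₊ = higher } q k = begin
  coeff (scale a q ⊕ (+ 0 ∷ (p ⊗ q))) k            ≡⟨ coeff-⊕ (scale a q) _ k ⟩
  coeff (scale a q) k + coeff (+ 0 ∷ (p ⊗ q)) k   ≡⟨ cong₂ _+_ (coeff-scale a q k) (λ-part k) ⟩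
  a * coeff q k + d * shift (coeff q) k           ∎
  where
  open ≡-Reasoning
  λ-part : ∀ k → coeff (+ 0 ∷ (p ⊗ q)) k ≡ d * shift (coeff q) k
  λ-part zero    = sym (ℤP.*-zeroʳ d)
  λ-part (suc k) = coeff-⊗-constant p p₀≡d higher q k

∑ₛ : ∀ {n} → ((Fin n → Bool) → ℤ) → ℤ
∑ₛ {zero}  f = f (λ ())
∑ₛ {suc n} f = ∑ₛ (λ S → f (false ∷ᵛ S)) + ∑ₛ (λ S → f (true ∷ᵛ S))

-- There is no function extensionality, so re-indexing subset sums needs summands that respect ≗.
Extensional : ∀ {n} → ((Fin n → Bool) → ℤ) → Set
Extensional f = f Preserves _≗_ ⟶ _≡_

∑ₛ-cong : ∀ {n} {f g : (Fin n → Bool) → ℤ} → (∀ S → f S ≡ g S) → ∑ₛ f ≡ ∑ₛ g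
∑ₛ-cong {zero}  h = h _
∑ₛ-cong {suc n} h = cong₂ _+_ (∑ₛ-cong (h ∘ (false ∷ᵛ_))) (∑ₛ-cong (h ∘ (true ∷ᵛ_)))

∑ₛ-zero : ∀ n → ∑ₛ {n} (λ _ → + 0) ≡ + 0
∑ₛ-zero zero    = refl
∑ₛ-zero (suc n) = cong₂ _+_ (∑ₛ-zero n) (∑ₛ-zero n)

∑ₛ-+ : ∀ {n} (f g : (Fin n → Bool) → ℤ) → ∑ₛ (λ S → f S + g S) ≡ ∑ₛ f + ∑ₛ g
∑ₛ-+ {zero}  f g = refl
∑ₛ-+ {suc n} f g = begin
  ∑ₛ (λ S → f (false ∷ᵛ S) + g (false ∷ᵛ S)) + ∑ₛ (λ S → f (true ∷ᵛ S) + g (true ∷ᵛ S))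
    ≡⟨ cong₂ _+_ (∑ₛ-+ (f ∘ (false ∷ᵛ_)) (g ∘ (false ∷ᵛ_))) (∑ₛ-+ (f ∘ (true ∷ᵛ_)) (g ∘ (true ∷ᵛ_))) ⟩
  (f₀ + g₀) + (f₁ + g₁)
    ≡⟨ solve 4 (λ a b c d → (a :+ b) :+ (c :+ d) := (a :+ c) :+ (b :+ d)) refl f₀ g₀ f₁ g₁ ⟩
  (f₀ + f₁) + (g₀ + g₁) ∎
  where
  open ≡-Reasoning
  f₀ = ∑ₛ (f ∘ (false ∷ᵛ_)); f₁ = ∑ₛ (f ∘ (true ∷ᵛ_))
  g₀ = ∑ₛ (g ∘ (false ∷ᵛ_)); g₁ = ∑ₛ (g ∘ (true ∷ᵛ_))

∑ₛ-* : ∀ {n} c (f : (Fin n → Bool) → ℤ) → ∑ₛ (λ S → c * f S) ≡ c * ∑ₛ f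
∑ₛ-* {zero}  c f = refl
∑ₛ-* {suc n} c f = trans (cong₂ _+_ (∑ₛ-* c (f ∘ (false ∷ᵛ_))) (∑ₛ-* c (f ∘ (true ∷ᵛ_))))
                         (sym (ℤP.*-distribˡ-+ c (∑ₛ (f ∘ (false ∷ᵛ_))) (∑ₛ (f ∘ (true ∷ᵛ_)))))

∑ₛ-sum : ∀ {n m} (g : Fin m → (Fin n → Bool) → ℤ) → ∑ₛ (λ S → sum λ j → g j S) ≡ sum λ j → ∑ₛ (g j)
∑ₛ-sum {n} {zero}  g = ∑ₛ-zero n
∑ₛ-sum {n} {suc m} g = trans (∑ₛ-+ (g zero) _) (cong (λ s → ∑ₛ (g zero) + s) (∑ₛ-sum (g ∘ suc)))

∑ₛ-sum-interchange : ∀ {n m} (w : (Fin n → Bool) → ℤ) (a b : Fin m → ℤ) (g : Fin m → (Fin n → Bool) → ℤ) →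
  ∑ₛ (λ S → w S * sum λ j → a j * (b j * g j S)) ≡ sum λ j → (a j * b j) * ∑ₛ λ S → w S * g j S
∑ₛ-sum-interchange w a b g = begin
  ∑ₛ (λ S → w S * sum λ j → a j * (b j * g j S))
    ≡⟨ ∑ₛ-cong (λ S → *-distribˡ-sum (w S) λ j → a j * (b j * g j S)) ⟩
  ∑ₛ (λ S → sum λ j → w S * (a j * (b j * g j S)))
    ≡⟨ ∑ₛ-sum (λ j S → w S * (a j * (b j * g j S))) ⟩
  sum (λ j → ∑ₛ λ S → w S * (a j * (b j * g j S)))
    ≡⟨ sum-cong-≗ (λ j → trans (∑ₛ-cong λ S → solve 4 (λ x y z t → x :* (y :* (z :* t)) := (y :* z) :* (x :* t)) refl
                                                       (w S) (a j) (b j) (g j S))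
                               (∑ₛ-* (a j * b j) λ S → w S * g j S)) ⟩
  sum (λ j → (a j * b j) * ∑ₛ λ S → w S * g j S) ∎
  where open ≡-Reasoning

∑ₛ-mono-≤ : ∀ {n} {f g : (Fin n → Bool) → ℤ} → (∀ S → f S ≤ g S) → ∑ₛ f ≤ ∑ₛ g
∑ₛ-mono-≤ {zero}  h = h _
∑ₛ-mono-≤ {suc n} h = ℤP.+-mono-≤ (∑ₛ-mono-≤ (h ∘ (false ∷ᵛ_))) (∑ₛ-mono-≤ (h ∘ (true ∷ᵛ_)))

∷ᵛ-head-tail : ∀ {n} (S : Fin (suc n) → Bool) → S ≗ (S zero ∷ᵛ (S ∘ suc))
∷ᵛ-head-tail S zero    = refl
∷ᵛ-head-tail S (suc x) = refl

∷ᵛ-cong : ∀ {n} b {S S′ : Fin n → Bool} → S ≗ S′ → (b ∷ᵛ S) ≗ (b ∷ᵛ S′)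
∷ᵛ-cong b eq zero    = refl
∷ᵛ-cong b eq (suc x) = eq x

∑ₛ-mono-< : ∀ {n} {f g : (Fin n → Bool) → ℤ} → Extensional f → Extensional g →
            (∀ S → f S ≤ g S) → ∀ S₀ → f S₀ < g S₀ → ∑ₛ f < ∑ₛ g
∑ₛ-mono-< {zero}  ext-f ext-g h S₀ lt = subst₂ _<_ (ext-f λ ()) (ext-g λ ()) lt
∑ₛ-mono-< {suc n} {f} {g} ext-f ext-g h S₀ lt =
  split (S₀ zero) (∑ₛ-mono-< (ext-f ∘ ∷ᵛ-cong _) (ext-g ∘ ∷ᵛ-cong _) (h ∘ (S₀ zero ∷ᵛ_)) (S₀ ∘ suc) lt′)
  where
  lt′ : f (S₀ zero ∷ᵛ (S₀ ∘ suc)) < g (S₀ zero ∷ᵛ (S₀ ∘ suc))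
  lt′ = subst₂ _<_ (ext-f (∷ᵛ-head-tail S₀)) (ext-g (∷ᵛ-head-tail S₀)) lt
  split : ∀ b → ∑ₛ (f ∘ (b ∷ᵛ_)) < ∑ₛ (g ∘ (b ∷ᵛ_)) → ∑ₛ f < ∑ₛ g
  split false lt₀ = ℤP.+-mono-<-≤ lt₀ (∑ₛ-mono-≤ (h ∘ (true ∷ᵛ_)))
  split true  lt₁ = ℤP.+-mono-≤-< (∑ₛ-mono-≤ (h ∘ (false ∷ᵛ_))) lt₁

transpose-ˡ : ∀ {n} (i j : Fin n) → transpose i j i ≡ j
transpose-ˡ i j rewrite dec-true (i FinP.≟ i) refl = refl

transpose-ʳ : ∀ {n} (i j : Fin n) → transpose i j j ≡ i
transpose-ʳ i j with j FinP.≟ i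
... | yes j≡i = j≡i
... | no j≢i rewrite dec-true (j FinP.≟ j) refl = refl

transpose-other : ∀ {n} {i j k : Fin n} → ¬ k ≡ i → ¬ k ≡ j → transpose i j k ≡ k
transpose-other {i = i} {j} {k} k≢i k≢j rewrite dec-false (k FinP.≟ i) k≢i | dec-false (k FinP.≟ j) k≢j = refl

-- The lemmas below split with case_of_, since a with on k ≟ i would also abstract
-- the test inside transpose and block the base lemmas.
transpose-same : ∀ {n} (i k : Fin n) → transpose i i k ≡ k
transpose-same i k = case k FinP.≟ i of λ where
  (yes refl) → transpose-ˡ k k
  (no k≢i)   → transpose-other k≢i k≢i

transpose-comm : ∀ {n} (i j k : Fin n) → transpose i j k ≡ transpose j i k
transpose-comm i j k = case ((k FinP.≟ i) , (k FinP.≟ j)) of λ where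
  (yes refl , _)        → trans (transpose-ˡ k j) (sym (transpose-ʳ j k))
  (no _     , yes refl) → trans (transpose-ʳ i k) (sym (transpose-ˡ k i))
  (no k≢i   , no k≢j)   → trans (transpose-other k≢i k≢j) (sym (transpose-other k≢j k≢i))

transpose-involutive : ∀ {n} (i j k : Fin n) → transpose i j (transpose i j k) ≡ k
transpose-involutive i j k = case ((k FinP.≟ i) , (k FinP.≟ j)) of λ where
  (yes refl , _)        → trans (cong (transpose k j) (transpose-ˡ k j)) (transpose-ʳ k j)
  (no _     , yes refl) → trans (cong (transpose i k) (transpose-ʳ i k)) (transpose-ˡ i k)
  (no k≢i   , no k≢j)   → trans (cong (transpose i j) (transpose-other k≢i k≢j)) (transpose-other k≢i k≢j)

transpose-suc : ∀ {n} (i j k : Fin n) → transpose (suc i) (suc j) (suc k) ≡ suc (transpose i j k)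
transpose-suc i j k = case ((k FinP.≟ i) , (k FinP.≟ j)) of λ where
  (yes refl , _)        → trans (transpose-ˡ (suc k) (suc j)) (cong suc (sym (transpose-ˡ k j)))
  (no _     , yes refl) → trans (transpose-ʳ (suc i) (suc k)) (cong suc (sym (transpose-ʳ i k)))
  (no k≢i   , no k≢j)   → trans (transpose-other (k≢i ∘ FinP.suc-injective) (k≢j ∘ FinP.suc-injective))
                                (cong suc (sym (transpose-other k≢i k≢j)))

insertAt-suc : ∀ {m} b (R : Fin m → Bool) i c → insertAt (b ∷ᵛ R) (suc i) c ≗ (b ∷ᵛ insertAt R i c)
insertAt-suc b R i c zero    = refl
insertAt-suc b R i c (suc x) = refl

insertAt-≢ : ∀ {m} (R : Fin m → Bool) {i x : Fin (suc m)} b c → ¬ x ≡ i → insertAt R i b x ≡ insertAt R i c x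
insertAt-≢ R {i} b c x≢i = begin
  insertAt R i b _                            ≡⟨ cong (insertAt R i b) (sym (punchIn-punchOut i≢x)) ⟩
  insertAt R i b (punchIn i (punchOut i≢x))   ≡⟨ insertAt-punchIn R i b _ ⟩
  R (punchOut i≢x)                            ≡⟨ insertAt-punchIn R i c _ ⟨
  insertAt R i c (punchIn i (punchOut i≢x))   ≡⟨ cong (insertAt R i c) (punchIn-punchOut i≢x) ⟩
  insertAt R i c _                            ∎
  where
  open ≡-Reasoning
  i≢x = x≢i ∘ sym

∑ₛ-insertAt : ∀ {m} (i : Fin (suc m)) {f : (Fin (suc m) → Bool) → ℤ} → Extensional f →
              ∑ₛ f ≡ ∑ₛ (λ R → f (insertAt R i false)) + ∑ₛ (λ R → f (insertAt R i true))
∑ₛ-insertAt {m} zero ext = cong₂ _+_ (∑ₛ-cong λ R → ext (head-tail false R)) (∑ₛ-cong λ R → ext (head-tail true R))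
  where
  head-tail : ∀ b (R : Fin m → Bool) → (b ∷ᵛ R) ≗ insertAt R zero b
  head-tail b R zero    = refl
  head-tail b R (suc x) = refl
∑ₛ-insertAt {suc m} (suc i) {f} ext = begin
  ∑ₛ (f ∘ (false ∷ᵛ_)) + ∑ₛ (f ∘ (true ∷ᵛ_))
    ≡⟨ cong₂ _+_ (∑ₛ-insertAt i (ext ∘ ∷ᵛ-cong false)) (∑ₛ-insertAt i (ext ∘ ∷ᵛ-cong true)) ⟩
  (part false false + part false true) + (part true false + part true true)
    ≡⟨ solve 4 (λ a b c d → (a :+ b) :+ (c :+ d) := (a :+ c) :+ (b :+ d)) refl
         (part false false) (part false true) (part true false) (part true true) ⟩
  (part false false + part true false) + (part false true + part true true)
    ≡⟨ cong₂ _+_ (cong₂ _+_ (moved false false) (moved true false)) (cong₂ _+_ (moved false true) (moved true true)) ⟩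
  ∑ₛ (λ R → f (insertAt R (suc i) false)) + ∑ₛ (λ R → f (insertAt R (suc i) true)) ∎
  where
  open ≡-Reasoning
  part : Bool → Bool → ℤ
  part b c = ∑ₛ λ R → f (b ∷ᵛ insertAt R i c)
  moved : ∀ b c → part b c ≡ ∑ₛ λ R → f (insertAt (b ∷ᵛ R) (suc i) c)
  moved b c = ∑ₛ-cong λ R → ext (λ x → sym (insertAt-suc b R i c x))

-- Splitting off positions 0 and suc v, the transposition exchanges the two mixed quarters of the sum.
∑ₛ-transpose₀ : ∀ {m} (v : Fin m) {f : (Fin (suc m) → Bool) → ℤ} → Extensional f →
                ∑ₛ f ≡ ∑ₛ (λ S → f (S ∘ transpose zero (suc v)))
∑ₛ-transpose₀ {suc m} v {f} ext = begin
  ∑ₛ (f ∘ (false ∷ᵛ_)) + ∑ₛ (f ∘ (true ∷ᵛ_))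
    ≡⟨ cong₂ _+_ (∑ₛ-insertAt v (ext ∘ ∷ᵛ-cong false)) (∑ₛ-insertAt v (ext ∘ ∷ᵛ-cong true)) ⟩
  (part false false + part false true) + (part true false + part true true)
    ≡⟨ solve 4 (λ a b c d → (a :+ b) :+ (c :+ d) := (a :+ c) :+ (b :+ d)) refl
         (part false false) (part false true) (part true false) (part true true) ⟩
  (part false false + part true false) + (part false true + part true true)
    ≡⟨ cong₂ _+_ (sym (swapped false)) (sym (swapped true)) ⟩
  ∑ₛ (λ S → f ((false ∷ᵛ S) ∘ τ)) + ∑ₛ (λ S → f ((true ∷ᵛ S) ∘ τ)) ∎
  where
  open ≡-Reasoning
  τ = transpose zero (suc v)
  part : Bool → Bool → ℤ
  part b c = ∑ₛ λ R → f (b ∷ᵛ insertAt R v c)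
  exchange : ∀ b c R → ((c ∷ᵛ insertAt R v b) ∘ τ) ≗ (b ∷ᵛ insertAt R v c)
  exchange b c R zero = trans (cong (c ∷ᵛ insertAt R v b) (transpose-ˡ zero (suc v))) (insertAt-lookup R v b)
  exchange b c R (suc x) = case x FinP.≟ v of λ where
    (yes refl) → trans (cong (c ∷ᵛ insertAt R x b) (transpose-ʳ zero (suc x))) (sym (insertAt-lookup R x c))
    (no x≢v)   → trans (cong (c ∷ᵛ insertAt R v b) (transpose-other {i = zero} (λ ()) (x≢v ∘ FinP.suc-injective)))
                       (insertAt-≢ R b c x≢v)
  swapped : ∀ b → ∑ₛ (λ S → f ((b ∷ᵛ S) ∘ τ)) ≡ part false b + part true b
  swapped b = trans (∑ₛ-insertAt v (λ eq → ext (∷ᵛ-cong b eq ∘ τ)))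
                    (cong₂ _+_ (∑ₛ-cong λ R → ext (exchange false b R)) (∑ₛ-cong λ R → ext (exchange true b R)))

∑ₛ-transpose : ∀ {n} (u v : Fin n) {f : (Fin n → Bool) → ℤ} → Extensional f →
               ∑ₛ f ≡ ∑ₛ (λ S → f (S ∘ transpose u v))
∑ₛ-transpose zero    zero    ext = ∑ₛ-cong λ S → ext λ x → cong S (sym (transpose-same zero x))
∑ₛ-transpose zero    (suc v) ext = ∑ₛ-transpose₀ v ext
∑ₛ-transpose (suc u) zero    ext = trans (∑ₛ-transpose₀ u ext) (∑ₛ-cong λ S → ext λ x → cong S (transpose-comm zero (suc u) x))
∑ₛ-transpose {suc n} (suc u) (suc v) {f} ext =
  cong₂ _+_ (shifted false) (shifted true)
  where
  shifted : ∀ b → ∑ₛ (f ∘ (b ∷ᵛ_)) ≡ ∑ₛ (λ S → f ((b ∷ᵛ S) ∘ transpose (suc u) (suc v)))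
  shifted b = trans (∑ₛ-transpose u v (ext ∘ ∷ᵛ-cong b)) (∑ₛ-cong λ S → ext (commute b S))
    where
    commute : ∀ b S → (b ∷ᵛ (S ∘ transpose u v)) ≗ ((b ∷ᵛ S) ∘ transpose (suc u) (suc v))
    commute b S zero    = cong (b ∷ᵛ S) (sym (transpose-other {i = suc u} {suc v} {zero} (λ ()) (λ ())))
    commute b S (suc x) = cong (b ∷ᵛ S) (sym (transpose-suc u v x))

double-cancel-≤ : ∀ {x y} → x + x ≤ y + y → x ≤ y
double-cancel-≤ {x} {y} h with x ℤP.≤? y
... | yes x≤y = x≤y
... | no x≰y  = ⊥-elim (ℤP.<⇒≱ (ℤP.+-mono-< (ℤP.≰⇒> x≰y) (ℤP.≰⇒> x≰y)) h)

double-cancel-< : ∀ {x y} → x + x < y + y → x < y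
double-cancel-< {x} {y} h with x ℤP.<? y
... | yes x<y = x<y
... | no x≮y  = ⊥-elim (ℤP.<⇒≱ h (ℤP.+-mono-≤ (ℤP.≮⇒≥ x≮y) (ℤP.≮⇒≥ x≮y)))

∑ₛ-pairs : ∀ {n} (u v : Fin n) {f : (Fin n → Bool) → ℤ} → Extensional f →
           ∑ₛ f + ∑ₛ f ≡ ∑ₛ (λ S → f S + f (S ∘ transpose u v))
∑ₛ-pairs u v {f} ext = trans (cong (λ s → ∑ₛ f + s) (∑ₛ-transpose u v ext)) (sym (∑ₛ-+ f _))

∑ₛ-mono-≤-pairs : ∀ {n} (u v : Fin n) {f g : (Fin n → Bool) → ℤ} → Extensional f → Extensional g →
                  (∀ S → f S + f (S ∘ transpose u v) ≤ g S + g (S ∘ transpose u v)) → ∑ₛ f ≤ ∑ₛ g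
∑ₛ-mono-≤-pairs u v ext-f ext-g h =
  double-cancel-≤ (subst₂ _≤_ (sym (∑ₛ-pairs u v ext-f)) (sym (∑ₛ-pairs u v ext-g)) (∑ₛ-mono-≤ h))

∑ₛ-mono-<-pairs : ∀ {n} (u v : Fin n) {f g : (Fin n → Bool) → ℤ} → Extensional f → Extensional g →
                  (∀ S → f S + f (S ∘ transpose u v) ≤ g S + g (S ∘ transpose u v)) →
                  ∀ S₀ → f S₀ + f (S₀ ∘ transpose u v) < g S₀ + g (S₀ ∘ transpose u v) → ∑ₛ f < ∑ₛ g
∑ₛ-mono-<-pairs u v {f} {g} ext-f ext-g h S₀ lt =
  double-cancel-< (subst₂ _<_ (sym (∑ₛ-pairs u v ext-f)) (sym (∑ₛ-pairs u v ext-g))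
                              (∑ₛ-mono-< (paired ext-f) (paired ext-g) h S₀ lt))
  where
  paired : ∀ {f} → Extensional f → Extensional (λ S → f S + f (S ∘ transpose u v))
  paired ext eq = cong₂ _+_ (ext eq) (ext (eq ∘ transpose u v))

-- The coefficients of det(C + λD)

mix : ∀ {n} → (Fin n → Bool) → Matrix n → Matrix n → Matrix n
mix S D C i j = if S i then D i j else C i j

#true : ∀ {n} → (Fin n → Bool) → ℕ
#true {zero}  S = 0
#true {suc n} S = (if S zero then 1 else 0) ℕ.+ #true (S ∘ suc)

𝟙 : Bool → ℤ
𝟙 true  = + 1
𝟙 false = + 0

𝟙[_≡_] : ℕ → ℕ → ℤ
𝟙[ k ≡ m ] = 𝟙 (k ℕ.≡ᵇ m)

shift-cong : ∀ {f g : ℕ → ℤ} → (∀ k → f k ≡ g k) → ∀ k → shift f k ≡ shift g k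
shift-cong f≗g zero    = refl
shift-cong f≗g (suc k) = f≗g k

shift-∑ₛ : ∀ {n} (g : (Fin n → Bool) → ℤ) k →
           shift (λ k → ∑ₛ λ S → 𝟙[ k ≡ #true S ] * g S) k ≡ ∑ₛ λ S → 𝟙[ k ≡ suc (#true S) ] * g S
shift-∑ₛ {n} g zero    = sym (trans (∑ₛ-cong λ S → ℤP.*-zeroˡ (g S)) (∑ₛ-zero n))
shift-∑ₛ     g (suc k) = refl

coeff-det-affine : ∀ {n} (M : Fin n → Fin n → Poly) (C D : Matrix n) → (∀ i j → Affine (M i j) (C i j) (D i j)) →
                   ∀ k → coeff (det M) k ≡ ∑ₛ λ S → 𝟙[ k ≡ #true S ] * detℤ (mix S D C)
coeff-det-affine {zero}  M C D aff zero    = refl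
coeff-det-affine {zero}  M C D aff (suc k) = refl
coeff-det-affine {suc n} M C D aff k = begin
  coeff (det M) k
    ≡⟨ coeff-sumFin (λ j → scale (s j) (M zero j ⊗ det (minor zero j M))) k ⟩
  sum (λ j → coeff (scale (s j) (M zero j ⊗ det (minor zero j M))) k)
    ≡⟨ sum-cong-≗ (λ j → trans (coeff-scale (s j) (M zero j ⊗ det (minor zero j M)) k)
                                (cong (s j *_) (coeff-⊗-affine (aff zero j) (det (minor zero j M)) k))) ⟩
  sum (λ j → s j * (C zero j * coeff (det (minor zero j M)) k + D zero j * shift (coeff (det (minor zero j M))) k))
    ≡⟨ sum-cong-≗ (λ j → cong (s j *_) (cong₂ (λ a b → C zero j * a + D zero j * b) (IH j k)
                                          (trans (shift-cong (IH j) k) (shift-∑ₛ (d j) k)))) ⟩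
  sum (λ j → s j * (C zero j * ∑ₛ (w₀ j) + D zero j * ∑ₛ (w₁ j)))
    ≡⟨ sum-cong-≗ (λ j → solve 5 (λ a b c x y → a :* (b :* x :+ c :* y) := (a :* b) :* x :+ (a :* c) :* y) refl
                                 (s j) (C zero j) (D zero j) (∑ₛ (w₀ j)) (∑ₛ (w₁ j))) ⟩
  sum (λ j → (s j * C zero j) * ∑ₛ (w₀ j) + (s j * D zero j) * ∑ₛ (w₁ j))
    ≡⟨ ∑-distrib-+ (λ j → (s j * C zero j) * ∑ₛ (w₀ j)) (λ j → (s j * D zero j) * ∑ₛ (w₁ j)) ⟩
  sum (λ j → (s j * C zero j) * ∑ₛ (w₀ j)) + sum (λ j → (s j * D zero j) * ∑ₛ (w₁ j))
    ≡⟨ cong₂ _+_ (∑ₛ-sum-interchange (λ S → 𝟙[ k ≡ #true S ]) s (C zero) d)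
                 (∑ₛ-sum-interchange (λ S → 𝟙[ k ≡ suc (#true S) ]) s (D zero) d) ⟨
  ∑ₛ (λ S → 𝟙[ k ≡ #true S ] * detℤ (mix (false ∷ᵛ S) D C)) + ∑ₛ (λ S → 𝟙[ k ≡ suc (#true S) ] * detℤ (mix (true ∷ᵛ S) D C)) ∎
  where
  open ≡-Reasoning
  s : Fin (suc n) → ℤ
  s j = sign (toℕ' j)
  d : Fin (suc n) → (Fin n → Bool) → ℤ
  d j S = detℤ (mix S (minor zero j D) (minor zero j C))
  w₀ w₁ : Fin (suc n) → (Fin n → Bool) → ℤ
  w₀ j S = 𝟙[ k ≡ #true S ] * d j S
  w₁ j S = 𝟙[ k ≡ suc (#true S) ] * d j S
  IH : ∀ j k → coeff (det (minor zero j M)) k ≡ ∑ₛ λ S → 𝟙[ k ≡ #true S ] * d j S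
  IH j = coeff-det-affine (minor zero j M) (minor zero j C) (minor zero j D) (λ a b → aff (suc a) (punchIn j b))

-- a₄ as a sum of principal 4 × 4 minors

#false : ∀ {n} → (Fin n → Bool) → ℕ
#false {zero}  S = 0
#false {suc n} S = (if S zero then 0 else 1) ℕ.+ #false (S ∘ suc)

#true+#false : ∀ {n} (S : Fin n → Bool) → #true S ℕ.+ #false S ≡ n
#true+#false {zero}  S = refl
#true+#false {suc n} S with S zero
... | true  = cong suc (#true+#false (S ∘ suc))
... | false = trans (ℕP.+-suc (#true (S ∘ suc)) _) (cong suc (#true+#false (S ∘ suc)))

𝟙-refl : ∀ k → 𝟙[ k ≡ k ] ≡ + 1
𝟙-refl zero    = refl
𝟙-refl (suc k) = 𝟙-refl k

𝟙-≢ : ∀ {k m} → ¬ k ≡ m → 𝟙[ k ≡ m ] ≡ + 0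
𝟙-≢ {zero}  {zero}  k≢m = ⊥-elim (k≢m refl)
𝟙-≢ {zero}  {suc m} k≢m = refl
𝟙-≢ {suc k} {zero}  k≢m = refl
𝟙-≢ {suc k} {suc m} k≢m = 𝟙-≢ (k≢m ∘ cong suc)

𝟙-cong : ∀ {k m k′ m′} → (k ≡ m → k′ ≡ m′) → (k′ ≡ m′ → k ≡ m) → 𝟙[ k ≡ m ] ≡ 𝟙[ k′ ≡ m′ ]
𝟙-cong {k} {m} {k′} to from with k ℕ.≟ m
... | yes refl = trans (𝟙-refl k) (sym (subst (λ m′ → 𝟙[ k′ ≡ m′ ] ≡ + 1) (to refl) (𝟙-refl k′)))
... | no k≢m   = trans (𝟙-≢ k≢m) (sym (𝟙-≢ (k≢m ∘ from)))

𝟙-*-mono-≤ : ∀ k m {x y} → (k ≡ m → x ≤ y) → 𝟙[ k ≡ m ] * x ≤ 𝟙[ k ≡ m ] * y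
𝟙-*-mono-≤ k m {x} {y} h with k ℕ.≟ m
... | yes k≡m = subst₂ _≤_ (sym (one k≡m x)) (sym (one k≡m y)) (h k≡m)
  where
  one : k ≡ m → ∀ z → 𝟙[ k ≡ m ] * z ≡ z
  one refl z = trans (cong (_* z) (𝟙-refl k)) (ℤP.*-identityˡ z)
... | no k≢m  = subst₂ _≤_ (sym (zero′ x)) (sym (zero′ y)) ℤP.≤-refl
  where
  zero′ : ∀ z → 𝟙[ k ≡ m ] * z ≡ + 0
  zero′ z = trans (cong (_* z) (𝟙-≢ k≢m)) (ℤP.*-zeroˡ z)

negAdj : ∀ {n} → Adj n → Matrix n
negAdj A i j = if A i j then - (+ 1) else + 0

-- det(−A) with the rows in S replaced by rows of I, i.e. the principal minor of −A on the complement of S.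
minorOutside : ∀ {n} → Adj n → (Fin n → Bool) → ℤ
minorOutside A S = detℤ (mix S I (negAdj A))

minorOutside-cong : ∀ {n} (B : Adj n) {S S′ : Fin n → Bool} → S ≗ S′ → minorOutside B S ≡ minorOutside B S′
minorOutside-cong B eq = detℤ-cong λ i j → cong (λ b → if b then I i j else negAdj B i j) (eq i)

charPoly-affine : ∀ {n} (A : Adj n) i j →
  Affine ((if i == j then (+ 0 ∷ + 1 ∷ []) else []) ⊕ (if A i j then (- (+ 1) ∷ []) else [])) (negAdj A i j) (I i j)
charPoly-affine A i j with i == j | A i j
... | true  | true  = record { coeff₀ = refl ; coeff₁ = refl ; coeff₂₊ = λ _ → refl }
... | true  | false = record { coeff₀ = refl ; coeff₁ = refl ; coeff₂₊ = λ _ → refl }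
... | false | true  = record { coeff₀ = refl ; coeff₁ = refl ; coeff₂₊ = λ _ → refl }
... | false | false = record { coeff₀ = refl ; coeff₁ = refl ; coeff₂₊ = λ _ → refl }

a₄≡∑-minorOutside : ∀ {n} (A : Adj n) → a₄ A ≡ ∑ₛ λ S → 𝟙[ #false S ≡ 4 ] * minorOutside A S
a₄≡∑-minorOutside {n} A with 4 ℕ.≤? n
... | yes 4≤n = trans (coeff-det-affine _ (negAdj A) I (charPoly-affine A) (n ∸ 4))
                      (∑ₛ-cong λ S → cong (_* minorOutside A S) (𝟙-cong (to S) (from S)))
  where
  to : ∀ S → n ∸ 4 ≡ #true S → #false S ≡ 4
  to S eq = ℕP.+-cancelˡ-≡ (#true S) _ _ (begin
    #true S ℕ.+ #false S   ≡⟨ #true+#false S ⟩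
    n                      ≡⟨ ℕP.m∸n+n≡m 4≤n ⟨
    n ∸ 4 ℕ.+ 4            ≡⟨ cong (ℕ._+ 4) eq ⟩
    #true S ℕ.+ 4          ∎)
    where open ≡-Reasoning
  from : ∀ S → #false S ≡ 4 → n ∸ 4 ≡ #true S
  from S eq = begin
    n ∸ 4                          ≡⟨ cong (_∸ 4) (#true+#false S) ⟨
    #true S ℕ.+ #false S ∸ 4       ≡⟨ cong (λ m → #true S ℕ.+ m ∸ 4) eq ⟩
    #true S ℕ.+ 4 ∸ 4              ≡⟨ ℕP.m+n∸n≡m (#true S) 4 ⟩
    #true S                        ∎
    where open ≡-Reasoning
... | no 4≰n = sym (trans (∑ₛ-cong λ S → cong (_* minorOutside A S) (𝟙-≢ (small S)))
                            (trans (∑ₛ-cong λ S → ℤP.*-zeroˡ (minorOutside A S)) (∑ₛ-zero n)))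
  where
  small : ∀ S → ¬ #false S ≡ 4
  small S eq = 4≰n (subst (ℕ._≤ n) eq (subst (#false S ℕ.≤_) (#true+#false S) (ℕP.m≤n+m (#false S) (#true S))))

Edges : Set → Set
Edges R = Bool → Bool → Bool → Bool → Bool → Bool → R

graph₄ : Edges (Adj 4)
graph₄ e₀₁ e₀₂ e₀₃ e₁₂ e₁₃ e₂₃ = λ where
  0F 1F → e₀₁ ; 0F 2F → e₀₂ ; 0F 3F → e₀₃ ; 1F 2F → e₁₂ ; 1F 3F → e₁₃ ; 2F 3F → e₂₃
  1F 0F → e₀₁ ; 2F 0F → e₀₂ ; 3F 0F → e₀₃ ; 2F 1F → e₁₂ ; 3F 1F → e₁₃ ; 3F 2F → e₂₃
  0F 0F → false ; 1F 1F → false ; 2F 2F → false ; 3F 3F → false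

-- Perfect matchings minus twice the 4-cycles. Opaque, so that unification treats it as a rigid symbol;
-- only the finite checks below unfold it.
opaque
  sachs₆ : Edges ℤ
  sachs₆ e₀₁ e₀₂ e₀₃ e₁₂ e₁₃ e₂₃ =
    (𝟙 (e₀₁ ∧ e₂₃) + 𝟙 (e₀₂ ∧ e₁₃) + 𝟙 (e₀₃ ∧ e₁₂))
    - + 2 * (𝟙 (e₀₁ ∧ e₁₂ ∧ e₂₃ ∧ e₀₃) + 𝟙 (e₀₁ ∧ e₁₃ ∧ e₂₃ ∧ e₀₂) + 𝟙 (e₀₂ ∧ e₁₂ ∧ e₁₃ ∧ e₀₃))

∀-Bool? : ∀ {P : Bool → Set} → Decidable P → Dec (∀ b → P b)
∀-Bool? P? with P? false | P? true
... | yes p₀ | yes p₁ = yes λ { false → p₀ ; true → p₁ }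
... | no ¬p₀ | _      = no λ p → ¬p₀ (p false)
... | yes _  | no ¬p₁ = no λ p → ¬p₁ (p true)

opaque
  unfolding sachs₆
  det-graph₄ : ∀ e₀₁ e₀₂ e₀₃ e₁₂ e₁₃ e₂₃ → detℤ (negAdj (graph₄ e₀₁ e₀₂ e₀₃ e₁₂ e₁₃ e₂₃)) ≡ sachs₆ e₀₁ e₀₂ e₀₃ e₁₂ e₁₃ e₂₃
  det-graph₄ = from-yes (∀-Bool? λ a → ∀-Bool? λ b → ∀-Bool? λ c → ∀-Bool? λ d → ∀-Bool? λ e → ∀-Bool? λ g →
    detℤ (negAdj (graph₄ a b c d e g)) ℤ.≟ sachs₆ a b c d e g)

  sachs₆-relabel : ∀ (a b c d : Fin 4) → ¬ a ≡ b → ¬ a ≡ c → ¬ a ≡ d → ¬ b ≡ c → ¬ b ≡ d → ¬ c ≡ d →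
    ∀ e₀₁ e₀₂ e₀₃ e₁₂ e₁₃ e₂₃ → let E = graph₄ e₀₁ e₀₂ e₀₃ e₁₂ e₁₃ e₂₃ in
    sachs₆ (E a b) (E a c) (E a d) (E b c) (E b d) (E c d) ≡ sachs₆ e₀₁ e₀₂ e₀₃ e₁₂ e₁₃ e₂₃
  sachs₆-relabel = from-yes (all? λ a → all? λ b → all? λ c → all? λ d →
    ¬? (a FinP.≟ b) →-dec ¬? (a FinP.≟ c) →-dec ¬? (a FinP.≟ d) →-dec
    ¬? (b FinP.≟ c) →-dec ¬? (b FinP.≟ d) →-dec ¬? (c FinP.≟ d) →-dec
    ∀-Bool? λ e₀₁ → ∀-Bool? λ e₀₂ → ∀-Bool? λ e₀₃ → ∀-Bool? λ e₁₂ → ∀-Bool? λ e₁₃ → ∀-Bool? λ e₂₃ →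
    let E = graph₄ e₀₁ e₀₂ e₀₃ e₁₂ e₁₃ e₂₃ in
    sachs₆ (E a b) (E a c) (E a d) (E b c) (E b d) (E c d) ℤ.≟ sachs₆ e₀₁ e₀₂ e₀₃ e₁₂ e₁₃ e₂₃)

  sachs₆-compress-both : ∀ a₂ a₃ b₂ b₃ e →
    sachs₆ false (a₂ ∧ b₂) (a₃ ∧ b₃) (b₂ ∨ a₂) (b₃ ∨ a₃) e ≤ sachs₆ false a₂ a₃ b₂ b₃ e
  sachs₆-compress-both = from-yes (∀-Bool? λ a₂ → ∀-Bool? λ a₃ → ∀-Bool? λ b₂ → ∀-Bool? λ b₃ → ∀-Bool? λ e →
    sachs₆ false (a₂ ∧ b₂) (a₃ ∧ b₃) (b₂ ∨ a₂) (b₃ ∨ a₃) e ℤP.≤? sachs₆ false a₂ a₃ b₂ b₃ e)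

  sachs₆-compress-both-< : ∀ e → sachs₆ false false false true true e < sachs₆ false false true true false e
  sachs₆-compress-both-< = from-yes (∀-Bool? λ e → sachs₆ false false false true true e ℤP.<? sachs₆ false false true true false e)

  sachs₆-compress-one : ∀ a₁ a₂ a₃ b₁ b₂ b₃ c d e →
    sachs₆ (a₁ ∧ b₁) (a₂ ∧ b₂) (a₃ ∧ b₃) c d e + sachs₆ (b₁ ∨ a₁) (b₂ ∨ a₂) (b₃ ∨ a₃) c d e
    ≤ sachs₆ a₁ a₂ a₃ c d e + sachs₆ b₁ b₂ b₃ c d e
  sachs₆-compress-one = from-yes (∀-Bool? λ a₁ → ∀-Bool? λ a₂ → ∀-Bool? λ a₃ → ∀-Bool? λ b₁ → ∀-Bool? λ b₂ → ∀-Bool? λ b₃ →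
    ∀-Bool? λ c → ∀-Bool? λ d → ∀-Bool? λ e →
    sachs₆ (a₁ ∧ b₁) (a₂ ∧ b₂) (a₃ ∧ b₃) c d e + sachs₆ (b₁ ∨ a₁) (b₂ ∨ a₂) (b₃ ∨ a₃) c d e
    ℤP.≤? sachs₆ a₁ a₂ a₃ c d e + sachs₆ b₁ b₂ b₃ c d e)

sachs : ∀ {n} → Adj n → (Fin 4 → Fin n) → ℤ
sachs B t = sachs₆ (B (t 0F) (t 1F)) (B (t 0F) (t 2F)) (B (t 0F) (t 3F)) (B (t 1F) (t 2F)) (B (t 1F) (t 3F)) (B (t 2F) (t 3F))

sachs₆-cong : ∀ {a b c d e g a′ b′ c′ d′ e′ g′} → a ≡ a′ → b ≡ b′ → c ≡ c′ → d ≡ d′ → e ≡ e′ → g ≡ g′ →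
              sachs₆ a b c d e g ≡ sachs₆ a′ b′ c′ d′ e′ g′
sachs₆-cong refl refl refl refl refl refl = refl

sachs-cong : ∀ {n m} {B : Adj n} {B′ : Adj m} {t t′} → (∀ i j → B (t i) (t j) ≡ B′ (t′ i) (t′ j)) → sachs B t ≡ sachs B′ t′
sachs-cong eq = sachs₆-cong (eq 0F 1F) (eq 0F 2F) (eq 0F 3F) (eq 1F 2F) (eq 1F 3F) (eq 2F 3F)

Symmetric Irreflexive : ∀ {n} → Adj n → Set
Symmetric B = ∀ x y → B x y ≡ B y x
Irreflexive B = ∀ x → B x x ≡ false

graph₄-edges : ∀ {B : Adj 4} → Symmetric B → Irreflexive B → ∀ i j →
  B i j ≡ graph₄ (B 0F 1F) (B 0F 2F) (B 0F 3F) (B 1F 2F) (B 1F 3F) (B 2F 3F) i j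
graph₄-edges {B} sym irr = λ where
  0F 1F → refl ; 0F 2F → refl ; 0F 3F → refl ; 1F 2F → refl ; 1F 3F → refl ; 2F 3F → refl
  1F 0F → sym 1F 0F ; 2F 0F → sym 2F 0F ; 3F 0F → sym 3F 0F ; 2F 1F → sym 2F 1F ; 3F 1F → sym 3F 1F ; 3F 2F → sym 3F 2F
  0F 0F → irr 0F ; 1F 1F → irr 1F ; 2F 2F → irr 2F ; 3F 3F → irr 3F

det-negAdj₄ : ∀ {B : Adj 4} → Symmetric B → Irreflexive B → detℤ (negAdj B) ≡ sachs B id
det-negAdj₄ {B} sym irr = trans (detℤ-cong λ i j → cong (λ b → if b then - (+ 1) else + 0) (graph₄-edges sym irr i j))
                                 (det-graph₄ (B 0F 1F) (B 0F 2F) (B 0F 3F) (B 1F 2F) (B 1F 3F) (B 2F 3F))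

sachs-relabel : ∀ {B : Adj 4} → Symmetric B → Irreflexive B → ∀ {t} → Injective _≡_ _≡_ t → sachs B t ≡ sachs B id
sachs-relabel {B} sym irr {t} inj = trans
  (sachs-cong {B = B} {B′ = graph₄ (B 0F 1F) (B 0F 2F) (B 0F 3F) (B 1F 2F) (B 1F 3F) (B 2F 3F)} {t = t} {t′ = t}
              λ i j → graph₄-edges sym irr (t i) (t j))
  (sachs₆-relabel (t 0F) (t 1F) (t 2F) (t 3F) (distinct 0F 1F λ ()) (distinct 0F 2F λ ()) (distinct 0F 3F λ ())
                  (distinct 1F 2F λ ()) (distinct 1F 3F λ ()) (distinct 2F 3F λ ())
                  (B 0F 1F) (B 0F 2F) (B 0F 3F) (B 1F 2F) (B 1F 3F) (B 2F 3F))
  where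
  distinct : ∀ i j → ¬ i ≡ j → ¬ t i ≡ t j
  distinct i j i≢j = i≢j ∘ inj

record Enumerates {n k} (S : Fin n → Bool) (t : Fin k → Fin n) : Set where
  field
    injective : Injective _≡_ _≡_ t
    outside   : ∀ i → S (t i) ≡ false
    covers    : ∀ y → S y ≡ false → ∃ λ i → t i ≡ y

_∪⁅_⁆ : ∀ {n} → (Fin n → Bool) → Fin n → Fin n → Bool
S ∪⁅ x ⁆ = updateAt S x (const true)

∪⁅⁆-here : ∀ {n} (S : Fin n → Bool) x → (S ∪⁅ x ⁆) x ≡ true
∪⁅⁆-here S x = updateAt-updates x S

∪⁅⁆-there : ∀ {n} (S : Fin n → Bool) {x y} → ¬ y ≡ x → (S ∪⁅ x ⁆) y ≡ S y
∪⁅⁆-there S {x} {y} y≢x = updateAt-minimal y x S y≢x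

false≢true : ∀ {n} (S : Fin n → Bool) {x y} → S x ≡ false → S y ≡ true → ¬ x ≡ y
false≢true S Sx Sy refl with trans (sym Sx) Sy
... | ()

==-false⁻¹ : ∀ {n} {x y : Fin n} → (x == y) ≡ false → ¬ x ≡ y
==-false⁻¹ {x = x} eq refl = false≢true (x ==_) eq (==-refl x) refl

#false-∪⁅⁆ : ∀ {n} (S : Fin n → Bool) x → S x ≡ false → #false S ≡ suc (#false (S ∪⁅ x ⁆))
#false-∪⁅⁆ {suc n} S zero    Sx rewrite Sx = refl
#false-∪⁅⁆ {suc n} S (suc x) Sx =
  trans (cong (c ℕ.+_) (#false-∪⁅⁆ (S ∘ suc) x Sx)) (ℕP.+-suc c _)
  where c = if S zero then 0 else 1

#false-∪⁅⁆-pred : ∀ {n k} (S : Fin n → Bool) {x} → S x ≡ false → #false S ≡ suc k → #false (S ∪⁅ x ⁆) ≡ k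
#false-∪⁅⁆-pred S {x} Sx eq = ℕP.suc-injective (trans (sym (#false-∪⁅⁆ S x Sx)) eq)

#false-cong : ∀ {n} {S S′ : Fin n → Bool} → S ≗ S′ → #false S ≡ #false S′
#false-cong {zero}  eq = refl
#false-cong {suc n} eq = cong₂ ℕ._+_ (cong (λ b → if b then 0 else 1) (eq zero)) (#false-cong (eq ∘ suc))

#false-suc : ∀ {n k} (S : Fin n → Bool) → #false S ≡ suc k → ∃ λ x → S x ≡ false
#false-suc {suc n} S eq with S zero in S₀
... | false = zero , S₀
... | true with #false-suc (S ∘ suc) eq
...   | x , Sx = suc x , Sx

#false-zero : ∀ {n} (S : Fin n → Bool) → #false S ≡ 0 → ∀ x → S x ≡ true
#false-zero {suc n} S eq x with S zero in S₀
#false-zero {suc n} S eq zero    | true = S₀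
#false-zero {suc n} S eq (suc x) | true = #false-zero (S ∘ suc) eq x

#false-all-true : ∀ {n} (S : Fin n → Bool) → (∀ x → S x ≡ true) → #false S ≡ 0
#false-all-true {zero}  S all-true = refl
#false-all-true {suc n} S all-true rewrite all-true zero = #false-all-true (S ∘ suc) (all-true ∘ suc)

enumerates-cong : ∀ {n k} {S S′ : Fin n → Bool} {t : Fin k → Fin n} → S ≗ S′ → Enumerates S t → Enumerates S′ t
enumerates-cong S≗S′ e = record
  { injective = injective
  ; outside   = λ i → trans (sym (S≗S′ _)) (outside i)
  ; covers    = λ y S′y → covers y (trans (S≗S′ y) S′y)
  }
  where open Enumerates e

enumerates-avoids : ∀ {n k} {S : Fin n → Bool} {t : Fin k → Fin n} → Enumerates S t → ∀ {x} → S x ≡ true → ∀ i → ¬ t i ≡ x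
enumerates-avoids e Sx i = false≢true _ (Enumerates.outside e i) Sx

enumerates-[] : ∀ {n} {S : Fin n → Bool} → (∀ y → S y ≡ true) → Enumerates S []ᵛ
enumerates-[] {S = S} all-true = record
  { injective = λ { {()} }
  ; outside   = λ ()
  ; covers    = λ y Sy → ⊥-elim (false≢true S Sy (all-true y) refl)
  }

Injective-∷ : ∀ {n k} {x : Fin n} {t : Fin k → Fin n} → (∀ i → ¬ t i ≡ x) →
              Injective _≡_ _≡_ t → Injective _≡_ _≡_ (x ∷ᵛ t)
Injective-∷ t≢x inj {zero}  {zero}  _  = refl
Injective-∷ t≢x inj {zero}  {suc j} eq = ⊥-elim (t≢x j (sym eq))
Injective-∷ t≢x inj {suc i} {zero}  eq = ⊥-elim (t≢x i eq)
Injective-∷ t≢x inj {suc i} {suc j} eq = cong suc (inj eq)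

enumerates-∷ : ∀ {n k} {S : Fin n → Bool} {x} {t : Fin k → Fin n} →
               S x ≡ false → Enumerates (S ∪⁅ x ⁆) t → Enumerates S (x ∷ᵛ t)
enumerates-∷ {S = S} {x} {t} Sx e = record { injective = Injective-∷ t≢x injective ; outside = out ; covers = cov }
  where
  open Enumerates e
  t≢x : ∀ i → ¬ t i ≡ x
  t≢x i = false≢true (S ∪⁅ x ⁆) (outside i) (∪⁅⁆-here S x)
  out : ∀ i → S ((x ∷ᵛ t) i) ≡ false
  out zero    = Sx
  out (suc i) = trans (sym (∪⁅⁆-there S (t≢x i))) (outside i)
  cov : ∀ y → S y ≡ false → ∃ λ i → (x ∷ᵛ t) i ≡ y
  cov y Sy with y FinP.≟ x
  ... | yes refl = zero , refl
  ... | no y≢x with covers y (trans (∪⁅⁆-there S y≢x) Sy)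
  ...   | i , ti≡y = suc i , ti≡y

enumerates-tail : ∀ {n k} {S : Fin n → Bool} {t : Fin (suc k) → Fin n} →
                  Enumerates S t → Enumerates (S ∪⁅ t zero ⁆) (t ∘ suc)
enumerates-tail {S = S} {t} e = record { injective = FinP.suc-injective ∘ injective ; outside = out ; covers = cov }
  where
  open Enumerates e
  t≢t₀ : ∀ i → ¬ t (suc i) ≡ t zero
  t≢t₀ i eq with injective eq
  ... | ()
  out : ∀ i → (S ∪⁅ t zero ⁆) (t (suc i)) ≡ false
  out i = trans (∪⁅⁆-there S (t≢t₀ i)) (outside (suc i))
  cov : ∀ y → (S ∪⁅ t zero ⁆) y ≡ false → ∃ λ i → t (suc i) ≡ y
  cov y Sy with y FinP.≟ t zero
  ... | yes refl = ⊥-elim (false≢true (S ∪⁅ y ⁆) Sy (∪⁅⁆-here S y) refl)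
  ... | no y≢t₀ with covers y (trans (sym (∪⁅⁆-there S y≢t₀)) Sy)
  ...   | zero  , t₀≡y = ⊥-elim (y≢t₀ (sym t₀≡y))
  ...   | suc i , ti≡y = i , ti≡y

enumerates-punchOut : ∀ {n k} {S : Fin (suc n) → Bool} {r} {t : Fin k → Fin (suc n)} → S r ≡ true →
  Enumerates S t → ∃ λ t′ → Enumerates (S ∘ punchIn r) t′ × (∀ i → punchIn r (t′ i) ≡ t i)
enumerates-punchOut {S = S} {r} {t} Sr e = t′ , record { injective = inj ; outside = out ; covers = cov } , t′-punchIn
  where
  open Enumerates e
  r≢t : ∀ i → ¬ r ≡ t i
  r≢t i = false≢true S (outside i) Sr ∘ sym
  t′ = λ i → punchOut (r≢t i)
  t′-punchIn : ∀ i → punchIn r (t′ i) ≡ t i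
  t′-punchIn i = punchIn-punchOut (r≢t i)
  inj : Injective _≡_ _≡_ t′
  inj {i} {j} eq = injective (trans (sym (t′-punchIn i)) (trans (cong (punchIn r) eq) (t′-punchIn j)))
  out : ∀ i → S (punchIn r (t′ i)) ≡ false
  out i = trans (cong S (t′-punchIn i)) (outside i)
  cov : ∀ y → S (punchIn r y) ≡ false → ∃ λ i → t′ i ≡ y
  cov y Sy with covers (punchIn r y) Sy
  ... | i , ti≡y = i , punchIn-injective r (t′ i) y (trans (t′-punchIn i) ti≡y)

enumeration-length : ∀ {n k} {S : Fin n → Bool} {t : Fin k → Fin n} → (∀ y → S y ≡ false) → Enumerates S t → n ≡ k
enumeration-length {n} {k} {S} {t} all-false e with ℕP.<-cmp n k
... | tri≈ _ n≡k _ = n≡k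
... | tri< n<k _ _ = ⊥-elim (collision (FinP.pigeonhole n<k t))
  where
  collision : (∃ λ i → ∃ λ j → i Fin.< j × t i ≡ t j) → ⊥
  collision (i , j , i<j , ti≡tj) = FinP.<⇒≢ i<j (Enumerates.injective e ti≡tj)
... | tri> _ _ k<n = ⊥-elim (collision (FinP.pigeonhole k<n index))
  where
  index : Fin n → Fin k
  index y = proj₁ (Enumerates.covers e y (all-false y))
  index-correct : ∀ y → t (index y) ≡ y
  index-correct y = proj₂ (Enumerates.covers e y (all-false y))
  collision : (∃ λ x → ∃ λ y → x Fin.< y × index x ≡ index y) → ⊥
  collision (x , y , x<y , same) = FinP.<⇒≢ x<y (trans (sym (index-correct x)) (trans (cong t same) (index-correct y)))

enumeration-#false : ∀ {n k} {S : Fin n → Bool} {t : Fin k → Fin n} → Enumerates S t → #false S ≡ k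
enumeration-#false {k = zero}  {S} e = #false-all-true S λ x → BoolP.¬-not λ Sx → case Enumerates.covers e x Sx of λ ()
enumeration-#false {k = suc k} {S} {t} e =
  trans (#false-∪⁅⁆ S (t zero) (Enumerates.outside e zero)) (cong suc (enumeration-#false (enumerates-tail e)))

complementOf : ∀ {n k} → (Fin k → Fin n) → Fin n → Bool
complementOf t y = not (does (any? λ i → t i FinP.≟ y))

enumerates-complementOf : ∀ {n k} {t : Fin k → Fin n} → Injective _≡_ _≡_ t → Enumerates (complementOf t) t
enumerates-complementOf {t = t} inj = record
  { injective = inj
  ; outside   = λ i → cong not (dec-true (any? λ j → t j FinP.≟ t i) (i , refl))
  ; covers    = cov
  }
  where
  cov : ∀ y → complementOf t y ≡ false → ∃ λ i → t i ≡ y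
  cov y h with any? (λ i → t i FinP.≟ y)
  ... | yes image = image

enumerate : ∀ {n k} (S : Fin n → Bool) → #false S ≡ k → ∃ (Enumerates {k = k} S)
enumerate {k = zero}  S eq = []ᵛ , enumerates-[] (#false-zero S eq)
enumerate {k = suc k} S eq with #false-suc S eq
... | x , Sx with enumerate (S ∪⁅ x ⁆) (#false-∪⁅⁆-pred S Sx eq)
...   | t , e = x ∷ᵛ t , enumerates-∷ Sx e

minorOutside-delete : ∀ {n} (B : Adj (suc n)) (S : Fin (suc n) → Bool) {r} → S r ≡ true →
  minorOutside B S ≡ minorOutside (λ x y → B (punchIn r x) (punchIn r y)) (S ∘ punchIn r)
minorOutside-delete B S {r} Sr = begin
  detℤ M                                    ≡⟨ detℤ-unitRow M r r unit-row ⟩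
  sign (toℕ' r ℕ.+ toℕ' r) * detℤ (minor r r M) ≡⟨ cong (_* detℤ (minor r r M)) (sign-double (toℕ' r)) ⟩
  + 1 * detℤ (minor r r M)                  ≡⟨ ℤP.*-identityˡ _ ⟩
  detℤ (minor r r M)                        ≡⟨ detℤ-cong entries ⟩
  minorOutside (λ x y → B (punchIn r x) (punchIn r y)) (S ∘ punchIn r) ∎
  where
  open ≡-Reasoning
  M = mix S I (negAdj B)
  unit-row : ∀ j → M r j ≡ I r j
  unit-row j rewrite Sr = refl
  entries : ∀ i j → minor r r M i j ≡ mix (S ∘ punchIn r) I (negAdj (λ x y → B (punchIn r x) (punchIn r y))) i j
  entries i j with S (punchIn r i)
  ... | true  = I-punchIn r i j
  ... | false = refl

minorOutside-sachs : ∀ {n} {B : Adj n} → Symmetric B → Irreflexive B →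
                     ∀ {S} {t : Fin 4 → Fin n} → Enumerates S t → minorOutside B S ≡ sachs B t
minorOutside-sachs {n} {B} sym irr {S} {t} e with any? (λ x → S x Bool.≟ true)
minorOutside-sachs {suc n} {B} sym irr {S} {t} e | yes (r , Sr) with enumerates-punchOut Sr e
... | t′ , e′ , t′-punchIn = begin
  minorOutside B S              ≡⟨ minorOutside-delete B S Sr ⟩
  minorOutside B∖r (S ∘ punchIn r) ≡⟨ minorOutside-sachs (λ x y → sym (punchIn r x) (punchIn r y)) (irr ∘ punchIn r) e′ ⟩
  sachs B∖r t′                  ≡⟨ sachs-cong {B = B∖r} {B} {t′} {t} (λ i j → cong₂ B (t′-punchIn i) (t′-punchIn j)) ⟩
  sachs B t                     ∎
  where
  open ≡-Reasoning
  B∖r : Adj n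
  B∖r x y = B (punchIn r x) (punchIn r y)
minorOutside-sachs {n} {B} sym irr {S} {t} e | no ∄true with enumeration-length (λ x → BoolP.¬-not (∄true ∘ (x ,_))) e
...   | refl = begin
  minorOutside B S      ≡⟨ minorOutside-cong B (λ x → BoolP.¬-not (∄true ∘ (x ,_))) ⟩
  detℤ (negAdj B)       ≡⟨ det-negAdj₄ sym irr ⟩
  sachs B id            ≡⟨ sachs-relabel sym irr (Enumerates.injective e) ⟨
  sachs B t             ∎
  where open ≡-Reasoning

module Compression {n} (A : Adj n) (symmetric : Symmetric A) (irreflexive : Irreflexive A) {u v : Fin n} (u≢v : ¬ u ≡ v) where

  A′ : Adj n
  A′ = compress A u v

  compress-u : ∀ {x} → ¬ x ≡ u → ¬ x ≡ v → A′ u x ≡ A u x ∧ A v x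
  compress-u {x} x≢u x≢v rewrite ==-refl u | ==-false u≢v | ==-false x≢u | ==-false x≢v | symmetric x u | symmetric x v
    with A u x | A v x
  ... | true  | true  = refl
  ... | true  | false = refl
  ... | false | true  = refl
  ... | false | false = refl

  compress-v : ∀ {x} → ¬ x ≡ u → ¬ x ≡ v → A′ v x ≡ A v x ∨ A u x
  compress-v {x} x≢u x≢v rewrite ==-refl v | ==-false (u≢v ∘ sym) | ==-false x≢u | ==-false x≢v | symmetric x u | symmetric x v
    with A u x | A v x
  ... | true  | true  = refl
  ... | true  | false = refl
  ... | false | true  = refl
  ... | false | false = refl

  compress-uv : A u v ≡ false → A′ u v ≡ false
  compress-uv uv rewrite ==-refl u | ==-refl v | ==-false u≢v | ==-false (u≢v ∘ sym) | uv = refl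

  compress-other : ∀ {x y} → ¬ x ≡ u → ¬ x ≡ v → ¬ y ≡ u → ¬ y ≡ v → A′ x y ≡ A x y
  compress-other x≢u x≢v y≢u y≢v rewrite ==-false x≢u | ==-false x≢v | ==-false y≢u | ==-false y≢v = refl

  compress-symmetric : Symmetric A′
  compress-symmetric x y rewrite symmetric x y
    | BoolP.∨-comm ((x == u) ∧ inN-u-v̄ A u v y) ((y == u) ∧ inN-u-v̄ A u v x)
    | BoolP.∨-comm ((x == v) ∧ inN-u-v̄ A u v y) ((y == v) ∧ inN-u-v̄ A u v x) = refl

  compress-irreflexive : Irreflexive A′
  compress-irreflexive x rewrite irreflexive x with x == u | x == v
  ... | true  | true  = refl
  ... | true  | false = refl
  ... | false | true  = refl
  ... | false | false = refl

-- A subset S stands for the 4-set outside it; those containing exactly one of u, v are only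
-- comparable in pairs {S, S ∘ σ}.

module Comparison {n} (A : Adj n) (symmetric : Symmetric A) (irreflexive : Irreflexive A)
                  {u v : Fin n} (u≢v : ¬ u ≡ v) (uv : A u v ≡ false) where

  open Compression A symmetric irreflexive u≢v public

  σ : Fin n → Fin n
  σ = transpose u v

  σ-fixes : ∀ {S : Fin n → Bool} → S u ≡ S v → S ∘ σ ≗ S
  σ-fixes {S} Su≡Sv z = case ((z FinP.≟ u) , (z FinP.≟ v)) of λ where
    (yes refl , _)        → trans (cong S (transpose-ˡ z v)) (sym Su≡Sv)
    (no _     , yes refl) → trans (cong S (transpose-ʳ u z)) Su≡Sv
    (no z≢u   , no z≢v)   → cong S (transpose-other z≢u z≢v)

  σ-involutive : ∀ (S : Fin n → Bool) → S ∘ σ ∘ σ ≗ S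
  σ-involutive S z = cong S (transpose-involutive u v z)

  σ-at-u : ∀ (S : Fin n → Bool) → (S ∘ σ) u ≡ S v
  σ-at-u S = cong S (transpose-ˡ u v)

  σ-at-v : ∀ (S : Fin n → Bool) → (S ∘ σ) v ≡ S u
  σ-at-v S = cong S (transpose-ʳ u v)

  ∪⁅u⁆-at-v : ∀ (S : Fin n → Bool) {b} → S v ≡ b → (S ∪⁅ u ⁆) v ≡ b
  ∪⁅u⁆-at-v S = trans (∪⁅⁆-there S (u≢v ∘ sym))

  σ-∪⁅⁆ : ∀ {S : Fin n → Bool} → S v ≡ true → S ∪⁅ u ⁆ ≗ (S ∘ σ) ∪⁅ v ⁆
  σ-∪⁅⁆ {S} Sv z = case ((z FinP.≟ v) , (z FinP.≟ u)) of λ where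
    (yes refl , _)        → trans (∪⁅u⁆-at-v S Sv) (sym (∪⁅⁆-here (S ∘ σ) z))
    (no z≢v   , yes refl) → trans (∪⁅⁆-here S z) (sym (trans (∪⁅⁆-there (S ∘ σ) z≢v) (trans (σ-at-u S) Sv)))
    (no z≢v   , no z≢u)   → trans (∪⁅⁆-there S z≢u) (sym (trans (∪⁅⁆-there (S ∘ σ) z≢v) (cong S (transpose-other z≢u z≢v))))

  #false-σ-one : ∀ {S : Fin n → Bool} → S u ≡ false → S v ≡ true → #false (S ∘ σ) ≡ #false S
  #false-σ-one {S} Su Sv = begin
    #false (S ∘ σ)                   ≡⟨ #false-∪⁅⁆ (S ∘ σ) v (trans (σ-at-v S) Su) ⟩
    suc (#false ((S ∘ σ) ∪⁅ v ⁆))    ≡⟨ cong suc (#false-cong (σ-∪⁅⁆ Sv)) ⟨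
    suc (#false (S ∪⁅ u ⁆))          ≡⟨ #false-∪⁅⁆ S u Su ⟨
    #false S                         ∎
    where open ≡-Reasoning

  #false-σ : ∀ (S : Fin n → Bool) → #false (S ∘ σ) ≡ #false S
  #false-σ S with S u in Su | S v in Sv
  ... | true  | true  = #false-cong (σ-fixes (trans Su (sym Sv)))
  ... | false | false = #false-cong (σ-fixes (trans Su (sym Sv)))
  ... | false | true  = #false-σ-one Su Sv
  ... | true  | false = trans (sym (#false-σ-one (trans (σ-at-u S) Sv) (trans (σ-at-v S) Su))) (#false-cong (σ-involutive S))

  minorOutside-avoiding : ∀ {S} → S u ≡ true → S v ≡ true → #false S ≡ 4 → minorOutside A′ S ≡ minorOutside A S
  minorOutside-avoiding {S} Su Sv four with enumerate S four
  ... | t , e = begin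
    minorOutside A′ S  ≡⟨ minorOutside-sachs compress-symmetric compress-irreflexive e ⟩
    sachs A′ t         ≡⟨ sachs-cong {B = A′} {A} {t} {t} (λ i j → compress-other (≢u i) (≢v i) (≢u j) (≢v j)) ⟩
    sachs A t          ≡⟨ minorOutside-sachs symmetric irreflexive e ⟨
    minorOutside A S   ∎
    where
    open ≡-Reasoning
    ≢u = enumerates-avoids e Su
    ≢v = enumerates-avoids e Sv

  module _ {S} {t : Fin 2 → Fin n} (e : Enumerates S (u ∷ᵛ v ∷ᵛ t)) where
    private
      ≢u : ∀ i → ¬ t i ≡ u
      ≢u i eq with Enumerates.injective e {suc (suc i)} {zero} eq
      ... | ()
      ≢v : ∀ i → ¬ t i ≡ v
      ≢v i eq with Enumerates.injective e {suc (suc i)} {suc zero} eq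
      ... | ()

    minorOutside-A′-both : minorOutside A′ S ≡
      sachs₆ false (A u (t 0F) ∧ A v (t 0F)) (A u (t 1F) ∧ A v (t 1F))
                   (A v (t 0F) ∨ A u (t 0F)) (A v (t 1F) ∨ A u (t 1F)) (A (t 0F) (t 1F))
    minorOutside-A′-both = trans (minorOutside-sachs compress-symmetric compress-irreflexive e)
      (sachs₆-cong (compress-uv uv) (compress-u (≢u 0F) (≢v 0F)) (compress-u (≢u 1F) (≢v 1F))
                   (compress-v (≢u 0F) (≢v 0F)) (compress-v (≢u 1F) (≢v 1F)) (compress-other (≢u 0F) (≢v 0F) (≢u 1F) (≢v 1F)))

    minorOutside-A-both : minorOutside A S ≡ sachs₆ false (A u (t 0F)) (A u (t 1F)) (A v (t 0F)) (A v (t 1F)) (A (t 0F) (t 1F))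
    minorOutside-A-both = trans (minorOutside-sachs symmetric irreflexive e) (sachs₆-cong uv refl refl refl refl refl)

  minorOutside-both : ∀ {S} → S u ≡ false → S v ≡ false → #false S ≡ 4 → minorOutside A′ S ≤ minorOutside A S
  minorOutside-both {S} Su Sv four
    with enumerate ((S ∪⁅ u ⁆) ∪⁅ v ⁆) (#false-∪⁅⁆-pred (S ∪⁅ u ⁆) (∪⁅u⁆-at-v S Sv) (#false-∪⁅⁆-pred S Su four))
  ... | t , e = subst₂ _≤_ (sym (minorOutside-A′-both e₄)) (sym (minorOutside-A-both e₄))
                           (sachs₆-compress-both (A u (t 0F)) (A u (t 1F)) (A v (t 0F)) (A v (t 1F)) (A (t 0F) (t 1F)))
    where e₄ = enumerates-∷ Su (enumerates-∷ (∪⁅u⁆-at-v S Sv) e)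

  minorOutside-one : ∀ {S} → S u ≡ false → S v ≡ true → #false S ≡ 4 →
    minorOutside A′ S + minorOutside A′ (S ∘ σ) ≤ minorOutside A S + minorOutside A (S ∘ σ)
  minorOutside-one {S} Su Sv four with enumerate (S ∪⁅ u ⁆) (#false-∪⁅⁆-pred S Su four)
  ... | t , e = subst₂ _≤_ (cong₂ _+_ (sym A′-u) (sym A′-v)) (cong₂ _+_ (sym A-u) (sym A-v))
    (sachs₆-compress-one (A u (t 0F)) (A u (t 1F)) (A u (t 2F)) (A v (t 0F)) (A v (t 1F)) (A v (t 2F))
                         (A (t 0F) (t 1F)) (A (t 0F) (t 2F)) (A (t 1F) (t 2F)))
    where
    eᵤ : Enumerates S (u ∷ᵛ t)
    eᵤ = enumerates-∷ Su e
    eᵥ : Enumerates (S ∘ σ) (v ∷ᵛ t)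
    eᵥ = enumerates-∷ (trans (σ-at-v S) Su) (enumerates-cong (σ-∪⁅⁆ Sv) e)
    ≢u = enumerates-avoids e (∪⁅⁆-here S u)
    ≢v = enumerates-avoids e (∪⁅u⁆-at-v S Sv)
    others : ∀ i j → A′ (t i) (t j) ≡ A (t i) (t j)
    others i j = compress-other (≢u i) (≢v i) (≢u j) (≢v j)
    A′-u : minorOutside A′ S ≡ sachs₆ (A u (t 0F) ∧ A v (t 0F)) (A u (t 1F) ∧ A v (t 1F)) (A u (t 2F) ∧ A v (t 2F))
                                      (A (t 0F) (t 1F)) (A (t 0F) (t 2F)) (A (t 1F) (t 2F))
    A′-u = trans (minorOutside-sachs compress-symmetric compress-irreflexive eᵤ)
      (sachs₆-cong (compress-u (≢u 0F) (≢v 0F)) (compress-u (≢u 1F) (≢v 1F)) (compress-u (≢u 2F) (≢v 2F))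
                   (others 0F 1F) (others 0F 2F) (others 1F 2F))
    A′-v : minorOutside A′ (S ∘ σ) ≡ sachs₆ (A v (t 0F) ∨ A u (t 0F)) (A v (t 1F) ∨ A u (t 1F)) (A v (t 2F) ∨ A u (t 2F))
                                            (A (t 0F) (t 1F)) (A (t 0F) (t 2F)) (A (t 1F) (t 2F))
    A′-v = trans (minorOutside-sachs compress-symmetric compress-irreflexive eᵥ)
      (sachs₆-cong (compress-v (≢u 0F) (≢v 0F)) (compress-v (≢u 1F) (≢v 1F)) (compress-v (≢u 2F) (≢v 2F))
                   (others 0F 1F) (others 0F 2F) (others 1F 2F))
    A-u : minorOutside A S ≡ sachs A (u ∷ᵛ t)
    A-u = minorOutside-sachs symmetric irreflexive eᵤ
    A-v : minorOutside A (S ∘ σ) ≡ sachs A (v ∷ᵛ t)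
    A-v = minorOutside-sachs symmetric irreflexive eᵥ

  minorOutside-pair-≤ : ∀ S → #false S ≡ 4 →
    minorOutside A′ S + minorOutside A′ (S ∘ σ) ≤ minorOutside A S + minorOutside A (S ∘ σ)
  minorOutside-pair-≤ S four with S u in Su | S v in Sv
  ... | true  | true  = ℤP.≤-reflexive (cong₂ _+_ (minorOutside-avoiding Su Sv four)
          (trans (minorOutside-cong A′ fixed) (trans (minorOutside-avoiding Su Sv four) (sym (minorOutside-cong A fixed)))))
    where fixed = σ-fixes (trans Su (sym Sv))
  ... | false | false = subst₂ _≤_ (cong (λ m → minorOutside A′ S + m) (sym (minorOutside-cong A′ fixed)))
                                  (cong (λ m → minorOutside A S + m) (sym (minorOutside-cong A fixed)))
                                  (ℤP.+-mono-≤ (minorOutside-both Su Sv four) (minorOutside-both Su Sv four))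
    where fixed = σ-fixes (trans Su (sym Sv))
  ... | false | true  = minorOutside-one Su Sv four
  ... | true  | false = subst₂ _≤_ (swap A′) (swap A)
          (minorOutside-one (trans (σ-at-u S) Sv) (trans (σ-at-v S) Su) (trans (#false-σ S) four))
    where
    swap : ∀ B → minorOutside B (S ∘ σ) + minorOutside B (S ∘ σ ∘ σ) ≡ minorOutside B S + minorOutside B (S ∘ σ)
    swap B = trans (cong (λ m → minorOutside B (S ∘ σ) + m) (minorOutside-cong B (σ-involutive S)))
                   (ℤP.+-comm (minorOutside B (S ∘ σ)) (minorOutside B S))

  weighted : Adj n → (Fin n → Bool) → ℤ
  weighted B S = 𝟙[ #false S ≡ 4 ] * minorOutside B S

  weighted-extensional : ∀ B → Extensional (weighted B)
  weighted-extensional B eq = cong₂ _*_ (cong 𝟙[_≡ 4 ] (#false-cong eq)) (minorOutside-cong B eq)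

  weighted-pair : ∀ B S → weighted B S + weighted B (S ∘ σ) ≡ 𝟙[ #false S ≡ 4 ] * (minorOutside B S + minorOutside B (S ∘ σ))
  weighted-pair B S = trans (cong (λ k → weighted B S + 𝟙[ k ≡ 4 ] * minorOutside B (S ∘ σ)) (#false-σ S))
                            (sym (ℤP.*-distribˡ-+ 𝟙[ #false S ≡ 4 ] (minorOutside B S) (minorOutside B (S ∘ σ))))

  weighted-pair-≤ : ∀ S → weighted A′ S + weighted A′ (S ∘ σ) ≤ weighted A S + weighted A (S ∘ σ)
  weighted-pair-≤ S = subst₂ _≤_ (sym (weighted-pair A′ S)) (sym (weighted-pair A S))
                                 (𝟙-*-mono-≤ (#false S) 4 (minorOutside-pair-≤ S))

  ∑-weighted-≤ : ∑ₛ (weighted A′) ≤ ∑ₛ (weighted A)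
  ∑-weighted-≤ = ∑ₛ-mono-≤-pairs u v (weighted-extensional A′) (weighted-extensional A) weighted-pair-≤

  module _ {x y : Fin n} (x≢u : ¬ x ≡ u) (x≢v : ¬ x ≡ v) (ux : A u x ≡ false) (vx : A v x ≡ true)
                         (y≢u : ¬ y ≡ u) (y≢v : ¬ y ≡ v) (uy : A u y ≡ true) (vy : A v y ≡ false) where

    private
      t₀ : Fin 4 → Fin n
      t₀ = u ∷ᵛ v ∷ᵛ x ∷ᵛ y ∷ᵛ []ᵛ

      y≢x : ¬ y ≡ x
      y≢x refl = false≢true (A u) ux uy refl

      t₀-injective : Injective _≡_ _≡_ t₀
      t₀-injective = Injective-∷ {t = v ∷ᵛ x ∷ᵛ y ∷ᵛ []ᵛ} (λ { 0F → u≢v ∘ sym ; 1F → x≢u ; 2F → y≢u })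
                    (Injective-∷ {t = x ∷ᵛ y ∷ᵛ []ᵛ} (λ { 0F → x≢v ; 1F → y≢v })
                    (Injective-∷ {t = y ∷ᵛ []ᵛ} (λ { 0F → y≢x })
                    (Injective-∷ {t = []ᵛ} (λ ()) λ { {()} })))

      S₀ : Fin n → Bool
      S₀ = complementOf t₀

      e₀ : Enumerates S₀ t₀
      e₀ = enumerates-complementOf t₀-injective

      minorOutside-< : minorOutside A′ S₀ < minorOutside A S₀
      minorOutside-< = subst₂ _<_
        (sym (trans (minorOutside-A′-both e₀)
                    (sachs₆-cong refl (cong₂ _∧_ ux vx) (cong₂ _∧_ uy vy) (cong₂ _∨_ vx ux) (cong₂ _∨_ vy uy) refl)))
        (sym (trans (minorOutside-A-both e₀) (sachs₆-cong refl ux uy vx vy refl)))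
        (sachs₆-compress-both-< (A x y))

      weighted-pair₀ : ∀ B → weighted B S₀ + weighted B (S₀ ∘ σ) ≡ minorOutside B S₀ + minorOutside B S₀
      weighted-pair₀ B = begin
        weighted B S₀ + weighted B (S₀ ∘ σ)                            ≡⟨ weighted-pair B S₀ ⟩
        𝟙[ #false S₀ ≡ 4 ] * (minorOutside B S₀ + minorOutside B (S₀ ∘ σ))
          ≡⟨ cong₂ (λ k m → 𝟙[ k ≡ 4 ] * (minorOutside B S₀ + m)) (enumeration-#false e₀) (minorOutside-cong B fixed) ⟩
        + 1 * (minorOutside B S₀ + minorOutside B S₀)                 ≡⟨ ℤP.*-identityˡ _ ⟩
        minorOutside B S₀ + minorOutside B S₀                          ∎
        where
        open ≡-Reasoning
        fixed = σ-fixes {S₀} (trans (Enumerates.outside e₀ 0F) (sym (Enumerates.outside e₀ 1F)))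

    ∑-weighted-< : ∑ₛ (weighted A′) < ∑ₛ (weighted A)
    ∑-weighted-< = ∑ₛ-mono-<-pairs u v (weighted-extensional A′) (weighted-extensional A) weighted-pair-≤ S₀
      (subst₂ _<_ (sym (weighted-pair₀ A′)) (sym (weighted-pair₀ A)) (ℤP.+-mono-< minorOutside-< minorOutside-<))

distance-two : ∀ {n} (G : SimpleGraph n) {u v} → Dis G u v 2 → ¬ u ≡ v × adj G u v ≡ false
distance-two G {u} {v} (_ , shortest) = u≢v , not-adjacent
  where
  u≢v : ¬ u ≡ v
  u≢v refl = shortest 0 (ℕ.s≤s ℕ.z≤n) here
  not-adjacent : adj G u v ≡ false
  not-adjacent with adj G u v in uv
  ... | false = refl
  ... | true  = ⊥-elim (shortest 1 (ℕ.s≤s (ℕ.s≤s ℕ.z≤n)) (step (subst T (sym uv) _) here))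

inN-ū-v-elim : ∀ {n} (A : Adj n) {u v x} → T (inN-ū-v A u v x) → ¬ x ≡ u × ¬ x ≡ v × A x u ≡ false × A x v ≡ true
inN-ū-v-elim A {u} {v} {x} h with x == u in xu | x == v in xv | A x u | A x v
... | false | false | false | true = ==-false⁻¹ xu , ==-false⁻¹ xv , refl , refl

inN-u-v̄-elim : ∀ {n} (A : Adj n) {u v x} → T (inN-u-v̄ A u v x) → ¬ x ≡ u × ¬ x ≡ v × A x u ≡ true × A x v ≡ false
inN-u-v̄-elim A {u} {v} {x} h with x == u in xu | x == v in xv | A x u | A x v
... | false | false | true | false = ==-false⁻¹ xu , ==-false⁻¹ xv , refl , refl

theorem3p3 : ∀ {n : ℕ} (G : SimpleGraph n) (u v : Fin n) → Dis G u v 2 →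
    (a₄ (compress (adj G) u v) ≤ a₄ (adj G))
    × ((Σ (Fin n) λ x → T (inN-ū-v (adj G) u v x)) →
       (Σ (Fin n) λ x → T (inN-u-v̄ (adj G) u v x)) →
       a₄ (compress (adj G) u v) < a₄ (adj G))
theorem3p3 G u v dist-uv = a₄-≤ , a₄-<
  where
  A = adj G
  open Comparison A (SimpleGraph.sym G) (irrefl G) (proj₁ (distance-two G dist-uv)) (proj₂ (distance-two G dist-uv))
  a₄-≤ : a₄ A′ ≤ a₄ A
  a₄-≤ = subst₂ _≤_ (sym (a₄≡∑-minorOutside A′)) (sym (a₄≡∑-minorOutside A)) ∑-weighted-≤
  a₄-< : (Σ (Fin _) λ x → T (inN-ū-v A u v x)) → (Σ (Fin _) λ y → T (inN-u-v̄ A u v y)) → a₄ A′ < a₄ A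
  a₄-< (x , x∈) (y , y∈) with inN-ū-v-elim A x∈ | inN-u-v̄-elim A y∈
  ... | x≢u , x≢v , xu , xv | y≢u , y≢v , yu , yv =
    subst₂ _<_ (sym (a₄≡∑-minorOutside A′)) (sym (a₄≡∑-minorOutside A))
      (∑-weighted-< x≢u x≢v (trans (SimpleGraph.sym G u x) xu) (trans (SimpleGraph.sym G v x) xv)
                    y≢u y≢v (trans (SimpleGraph.sym G u y) yu) (trans (SimpleGraph.sym G v y) yv))
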